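{- Let $r\ge1$, $t\ge 2$, and let $GT(r,t)$ be the glued $t$-ary tree with quasi-leaves $v_1,\dots,v_{t^r}$. If $S$ is a mutual-visibility set of $GT(r,t)$, then for all distinct $n,k\in[t^r]$ we have $|S\cap V(C_{n,k})|\le 3$.
   Context: A set $S\subseteq V(G)$ is a mutual-visibility set if for every $x,y\in S$ there is a shortest $x$–$y$ path in $G$ none of whose internal vertices lies in $S$. A perfect $t$-ary tree $T_{r,t}$ of depth $r\ge1$ is a rooted tree in which every non-leaf vertex has exactly $t$ children and all leaves have depth $r$. The glued $t$-ary tree $GT(r,t)$ is obtained from two copies $T^{(1)}$, $T^{(2)}$ of $T_{r,t}$ by pairwise identifying their leaves; the identified vertices are the quasi-leaves $v_1,\dots,v_{t^r}$. For distinct quasi-leaves $v_n,v_k$, let $P_{n,k}$ be the shortest $v_n$–$v_k$ path through $T^{(1)}$ and $P'_{n,k}$ the shortest $v_n$–$v_k$ path through $T^{(2)}$; $C_{n,k}$ is the cycle formed by $P_{n,k}\cup P'_{n,k}$. -}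

module Defs where

open import Data.Nat using (ℕ; _<_; _≤_)
open import Data.Bool using (Bool)
open import Data.Fin using (Fin)
open import Data.List using (List; []; _∷_; _++_; length)
open import Data.List.Relation.Unary.All using (All)
open import Data.List.Relation.Unary.Linked using (Linked)
open import Data.List.Membership.Propositional using (_∈_)
open import Data.Product using (Σ; proj₁; ∃; ∃-syntax; _×_)
open import Data.Unit using (⊤)
open import Data.Empty using (⊥)
open import Relation.Nullary using (¬_)
open import Relation.Binary.PropositionalEquality using (_≡_; _≢_)

-- A vertex of the perfect t-ary tree T_{r,t} at depth d is the word
-- (list of child indices, most recent step first) leading to it from the root.
--   inner b w : non-leaf vertex w of copy b (b = false ~ T^(1), b = true ~ T^(2)),
--               valid when length w < r
--   leaf w    : quasi-leaf (identified leaf of both copies), valid when length w = r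
data GV (t : ℕ) : Set where
  inner : Bool → List (Fin t) → GV t
  leaf  : List (Fin t) → GV t

Valid : {t : ℕ} → ℕ → GV t → Set
Valid r (inner b w) = length w < r
Valid r (leaf w)    = length w ≡ r

Vert : ℕ → ℕ → Set
Vert r t = Σ (GV t) (Valid r)

data AdjG {t : ℕ} : GV t → GV t → Set where
  child-inner  : ∀ b w a → AdjG (inner b w) (inner b (a ∷ w))
  child-leaf   : ∀ b w a → AdjG (inner b w) (leaf (a ∷ w))
  parent-inner : ∀ b w a → AdjG (inner b (a ∷ w)) (inner b w)
  parent-leaf  : ∀ b w a → AdjG (leaf (a ∷ w)) (inner b w)

Adj : {r t : ℕ} → Vert r t → Vert r t → Set
Adj u v = AdjG (proj₁ u) (proj₁ v)

IsWalkIn : {r t : ℕ} → (Vert r t → Set) → Vert r t → List (Vert r t) → Vert r t → Set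
IsWalkIn P x mid y = Linked Adj (x ∷ mid ++ y ∷ []) × All P (x ∷ mid ++ y ∷ [])

IsShortestIn : {r t : ℕ} → (Vert r t → Set) → Vert r t → List (Vert r t) → Vert r t → Set
IsShortestIn P x mid y =
  IsWalkIn P x mid y × (∀ mid′ → IsWalkIn P x mid′ y → length mid ≤ length mid′)

IsShortest : {r t : ℕ} → Vert r t → List (Vert r t) → Vert r t → Set
IsShortest = IsShortestIn (λ _ → ⊤)

-- Mutual-visibility set (S given as a predicate on vertices).
-- For x = y the trivial path has no internal vertices, so only x ≢ y matters.
IsMutualVisibilitySet : {r t : ℕ} → (Vert r t → Set) → Set
IsMutualVisibilitySet {r} {t} S =
  ∀ (x y : Vert r t) → S x → S y → x ≢ y →
  ∃[ mid ] (IsShortest x mid y × All (λ v → ¬ S v) mid)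

IsQuasiLeafG : {t : ℕ} → GV t → Set
IsQuasiLeafG (inner _ _) = ⊥
IsQuasiLeafG (leaf _)    = ⊤

IsQuasiLeaf : {r t : ℕ} → Vert r t → Set
IsQuasiLeaf v = IsQuasiLeafG (proj₁ v)

InCopyG : {t : ℕ} → Bool → GV t → Set
InCopyG b (inner b′ _) = b′ ≡ b
InCopyG b (leaf _)     = ⊤

InCopy : {r t : ℕ} → Bool → Vert r t → Set
InCopy b v = InCopyG b (proj₁ v)

-- v ∈ V(C_{x,y}) = V(P_{x,y}) ∪ V(P'_{x,y}): v lies on a shortest x–y path
-- inside T^(1) or inside T^(2).
OnCycle : {r t : ℕ} → Vert r t → Vert r t → Vert r t → Set
OnCycle x y v =
  ∃[ b ] ∃[ mid ] (IsShortestIn (InCopy b) x mid y × v ∈ (x ∷ mid ++ y ∷ []))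

-- Let the paths from x and y to the root meet at height h, so that C_{x,y} has length 4h: each
-- of its halves P_{x,y}, P′_{x,y} climbs from x to the fork in one copy and descends to y.
-- Heights change by one along every edge and copies change only at quasi-leaves, so a walk
-- whose length meets the obvious lower bound consists of straight climbs.  This pins down the
-- shortest paths between vertices of C_{x,y}: between two vertices of one half they follow that
-- half (unless the ends are x and y), and between vertices of different halves they follow one
-- half and change copies at a quasi-leaf below the lower end.  Hence among four vertices of S on
-- C_{x,y} some pair has all its shortest paths blocked by a third: the middle one of three
-- vertices on a half; for x and y, one of two inner vertices on different halves; and with two
-- inner vertices on each half, one of the two crossing pairs is blocked, because the height
-- along a half rises up to h and then falls.

module Submission where

open import Defs
open import Data.Bool using (Bool)
import Data.Bool
open import Data.Bool.Properties using (¬-not)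
open import Data.Empty using (⊥; ⊥-elim)
open import Data.Fin using (Fin)
import Data.Fin.Properties as Fin
open import Data.List using (List; []; _∷_; _++_; _∷ʳ_; length; drop; map; reverse)
open import Data.List.Properties using (drop-drop; length-drop; unfold-reverse; reverse-map; ≡-dec)
open import Data.List.Membership.Propositional using (_∈_)
open import Data.List.Membership.Propositional.Properties using (∈-map⁺; ∈-map⁻; ∈-++⁻)
open import Data.List.Relation.Binary.Subset.Propositional using (_⊆_)
open import Data.List.Relation.Unary.All as All using (All; []; _∷_)
open import Data.List.Relation.Unary.AllPairs using ([]; _∷_)
open import Data.List.Relation.Unary.Any using (Any; here; there)
import Data.List.Relation.Unary.Any.Properties as Any
open import Data.List.Relation.Unary.Linked using (Linked; [-]; _∷_)
open import Data.List.Relation.Unary.Unique.Propositional using (Unique)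
open import Data.Nat using (ℕ; zero; suc; _+_; _∸_; _⊓_; _≤_; _<_; z≤n; s≤s; _≟_; _≤?_; _<?_; ∣_-_∣)
open import Data.Nat.Properties
open import Data.Nat.Tactic.RingSolver using (solve-∀)
open import Data.Product using (Σ; ∃-syntax; _×_; _,_; proj₁; proj₂)
import Data.Product
open import Data.Sum using (_⊎_; inj₁; inj₂)
import Data.Sum
open import Data.Unit using (tt)
open import Function using (_∘_)
open import Relation.Binary.Definitions using (tri<; tri≈; tri>)
open import Relation.Binary.PropositionalEquality
open import Relation.Nullary using (¬_; Dec; yes; no)
open import Relation.Nullary.Decidable using (_×-dec_; _⊎-dec_; ¬?)

half-≤ : ∀ {a b} → a + a ≤ b + b → a ≤ b
half-≤ le = ≮⇒≥ (λ b<a → <⇒≱ (+-mono-< b<a b<a) le)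

+-tight : ∀ {a b x y} → a ≤ x → b ≤ y → x + y ≤ a + b → x ≤ a × y ≤ b
+-tight {a} {b} {x} {y} a≤x b≤y sum =
  +-cancelʳ-≤ y x a (≤-trans sum (+-monoʳ-≤ a b≤y)) , +-cancelˡ-≤ x y b (≤-trans sum (+-monoˡ-≤ b a≤x))

+-interleave : ∀ a b c d → a + b + c + d ≡ a + c + b + d
+-interleave = solve-∀

+-interleave′ : ∀ a b c d → a + b + c + d ≡ b + d + a + c
+-interleave′ = solve-∀

positive : ∀ {n p h} → p < h → h ≤ n + p → 1 ≤ n
positive {zero}  p<h h≤p = ⊥-elim (<⇒≱ p<h h≤p)
positive {suc n} _   _   = s≤s z≤n

cross-budget : ∀ {h l m x y} → h ≤ x → h + l ≤ y → x + y + l ≤ h + h + (m + m) → m ≤ l →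
  l ≤ m × x ≤ h × y ≤ h + l
cross-budget {h} {l} {m} {x} {y} h≤x h+l≤y budget m≤l = l≤m , +-tight h≤x h+l≤y sum≤
  where
    regroup : ∀ h l → h + (h + l) + l ≡ h + h + (l + l)
    regroup = solve-∀
    l≤m : l ≤ m
    l≤m = half-≤ (+-cancelˡ-≤ (h + h) (l + l) (m + m)
            (≤-trans (≤-reflexive (sym (regroup h l))) (≤-trans (+-monoˡ-≤ l (+-mono-≤ h≤x h+l≤y)) budget)))
    sum≤ : x + y ≤ h + (h + l)
    sum≤ = +-cancelʳ-≤ l (x + y) (h + (h + l))
            (≤-trans budget (≤-trans (+-monoʳ-≤ (h + h) (+-mono-≤ m≤l m≤l)) (≤-reflexive (sym (regroup h l)))))

+-shuffle : ∀ a b c d → a + b + c + d ≡ a + c + d + b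
+-shuffle = solve-∀

∸-split : ∀ {p q s} → p ≤ q → q ≤ s → (q ∸ p) + (s ∸ q) ≡ s ∸ p
∸-split {p} {q} {s} p≤q q≤s = +-cancelʳ-≡ p _ _ (begin
  q ∸ p + (s ∸ q) + p   ≡⟨ cong (_+ p) (+-comm (q ∸ p) (s ∸ q)) ⟩
  s ∸ q + (q ∸ p) + p   ≡⟨ +-assoc (s ∸ q) (q ∸ p) p ⟩
  s ∸ q + (q ∸ p + p)   ≡⟨ cong (s ∸ q +_) (m∸n+n≡m p≤q) ⟩
  s ∸ q + q             ≡⟨ m∸n+n≡m q≤s ⟩
  s                     ≡⟨ m∸n+n≡m (≤-trans p≤q q≤s) ⟨
  s ∸ p + p             ∎)
  where open ≡-Reasoning

drop-∷ : ∀ {A : Set} (L : List A) k → k < length L → ∃[ c ] drop k L ≡ c ∷ drop (suc k) L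
drop-∷ (x ∷ L) zero    _         = x , refl
drop-∷ (x ∷ L) (suc k) (s≤s k<n) = drop-∷ L k k<n

∸-cancelˡ : ∀ {r x y} → r ∸ x ≡ r ∸ y → y < r → x ≡ y
∸-cancelˡ {r} {x} {y} eq y<r with x ≤? r
... | yes x≤r = trans (sym (m∸[m∸n]≡n x≤r)) (trans (cong (r ∸_) eq) (m∸[m∸n]≡n (<⇒≤ y<r)))
... | no  x≰r = ⊥-elim (m>n⇒m∸n≢0 y<r (trans (sym eq) (m≤n⇒m∸n≡0 (<⇒≤ (≰⇒> x≰r)))))

drop-agree : ∀ {A : Set} {L M : List A} {l i} → l ≤ i → drop l L ≡ drop l M → drop i L ≡ drop i M
drop-agree {L = L} {M} {l} {i} l≤i eq = begin
  drop i L                ≡⟨ cong (λ k → drop k L) (m+[n∸m]≡n l≤i) ⟨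
  drop (l + (i ∸ l)) L    ≡⟨ drop-drop l (i ∸ l) L ⟨
  drop (i ∸ l) (drop l L) ≡⟨ cong (drop (i ∸ l)) eq ⟩
  drop (i ∸ l) (drop l M) ≡⟨ drop-drop l (i ∸ l) M ⟩
  drop (l + (i ∸ l)) M    ≡⟨ cong (λ k → drop k M) (m+[n∸m]≡n l≤i) ⟩
  drop i M                ∎
  where open ≡-Reasoning

length-drop-≡ : ∀ {A : Set} {r} (L : List A) → length L ≡ r → ∀ k → length (drop k L) ≡ r ∸ k
length-drop-≡ L lL k = trans (length-drop k L) (cong (_∸ k) lL)

Valid-irrelevant : ∀ {r t} (g : GV t) (p q : Valid r g) → p ≡ q
Valid-irrelevant (inner _ _) = <-irrelevant
Valid-irrelevant (leaf _)    = ≡-irrelevant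

vertex-≡ : ∀ {r t} {u v : Vert r t} → proj₁ u ≡ proj₁ v → u ≡ v
vertex-≡ {u = g , p} {v = .g , q} refl = cong (g ,_) (Valid-irrelevant g p q)

module _ {t : ℕ} where

  word : GV t → List (Fin t)
  word (inner _ w) = w
  word (leaf w)    = w

  depth : GV t → ℕ
  depth g = length (word g)

  -- a quasi-leaf lies in both copies; false is a junk value
  copyOf : GV t → Bool
  copyOf (inner b _) = b
  copyOf (leaf _)    = Bool.false

  InCopyG-copyOf : (g : GV t) → InCopyG (copyOf g) g
  InCopyG-copyOf (inner _ _) = refl
  InCopyG-copyOf (leaf _)    = tt

  InCopyG-inner : ∀ {c β L} {g : GV t} → InCopyG c g → g ≡ inner β L → β ≡ c
  InCopyG-inner g∈c refl = g∈c

  inner-injective : ∀ {b b′ w w′} → inner {t} b w ≡ inner b′ w′ → b ≡ b′ × w ≡ w′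
  inner-injective refl = refl , refl

  AdjG-sym : ∀ {g g′ : GV t} → AdjG g g′ → AdjG g′ g
  AdjG-sym (child-inner b w a)  = parent-inner b w a
  AdjG-sym (child-leaf b w a)   = parent-leaf b w a
  AdjG-sym (parent-inner b w a) = child-inner b w a
  AdjG-sym (parent-leaf b w a)  = child-leaf b w a

  AdjG-inner-copy : ∀ {b b′ w w′} → AdjG (inner {t} b w) (inner b′ w′) → b ≡ b′
  AdjG-inner-copy (child-inner _ _ _)  = refl
  AdjG-inner-copy (parent-inner _ _ _) = refl

module Walks {r t : ℕ} where

  V : Set
  V = Vert r t

  -- a record rather than Adj, so that both endpoints can be inferred
  record Edge (u v : V) : Set where
    constructor edge
    field adj : AdjG (proj₁ u) (proj₁ v)
  open Edge public

  Edge-sym : ∀ {u v} → Edge u v → Edge v u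
  Edge-sym (edge a) = edge (AdjG-sym a)

  infixr 5 _∷_ _++ʷ_

  data Walk : V → V → ℕ → Set where
    []  : ∀ {s} → Walk s s 0
    _∷_ : ∀ {s u e n} → Edge s u → Walk u e n → Walk s e (suc n)

  vertices : ∀ {s e n} → Walk s e n → List V
  vertices {s} []      = s ∷ []
  vertices {s} (_ ∷ w) = s ∷ vertices w

  trace : ∀ {s e n} → Walk s e n → List (GV t)
  trace w = map proj₁ (vertices w)

  head-Any : ∀ {s e n} {P : V → Set} (w : Walk s e n) → P s → Any P (vertices w)
  head-Any []      p = here p
  head-Any (_ ∷ _) p = here p

  start∈ : ∀ {s e n} (w : Walk s e n) → proj₁ s ∈ trace w
  start∈ []      = here refl
  start∈ (_ ∷ _) = here refl

  _++ʷ_ : ∀ {s u e m n} → Walk s u m → Walk u e n → Walk s e (m + n)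
  []      ++ʷ w′ = w′
  (a ∷ w) ++ʷ w′ = a ∷ (w ++ʷ w′)

  snocʷ : ∀ {s e e′ n} → Walk s e n → Edge e e′ → Walk s e′ (suc n)
  snocʷ []      a = a ∷ []
  snocʷ (b ∷ w) a = b ∷ snocʷ w a

  reverseʷ : ∀ {s e n} → Walk s e n → Walk e s n
  reverseʷ []      = []
  reverseʷ (a ∷ w) = snocʷ (reverseʷ w) (Edge-sym a)

  vertices-snocʷ : ∀ {s e e′ n} (w : Walk s e n) (a : Edge e e′) → vertices (snocʷ w a) ≡ vertices w ∷ʳ e′
  vertices-snocʷ []      a = refl
  vertices-snocʷ (b ∷ w) a = cong (_ ∷_) (vertices-snocʷ w a)

  vertices-reverseʷ : ∀ {s e n} (w : Walk s e n) → vertices (reverseʷ w) ≡ reverse (vertices w)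
  vertices-reverseʷ []              = refl
  vertices-reverseʷ {s} (a ∷ w) = begin
    vertices (snocʷ (reverseʷ w) (Edge-sym a)) ≡⟨ vertices-snocʷ (reverseʷ w) (Edge-sym a) ⟩
    vertices (reverseʷ w) ∷ʳ s                 ≡⟨ cong (_∷ʳ s) (vertices-reverseʷ w) ⟩
    reverse (vertices w) ∷ʳ s                  ≡⟨ unfold-reverse s (vertices w) ⟨
    reverse (s ∷ vertices w)                   ∎
    where open ≡-Reasoning

  trace-reverseʷ : ∀ {s e n} (w : Walk s e n) → trace (reverseʷ w) ≡ reverse (trace w)
  trace-reverseʷ w = trans (cong (map proj₁) (vertices-reverseʷ w)) (reverse-map proj₁ (vertices w))

  reverseʷ-⊆ : ∀ {s e n} (w : Walk s e n) → trace (reverseʷ w) ⊆ trace w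
  reverseʷ-⊆ w m = Any.reverse⁻ (subst (_ ∈_) (trace-reverseʷ w) m)

  ⊆-reverseʷ : ∀ {s e n} (w : Walk s e n) → trace w ⊆ trace (reverseʷ w)
  ⊆-reverseʷ w m = subst (_ ∈_) (sym (trace-reverseʷ w)) (Any.reverse⁺ m)

  record Split {s e n} (w : Walk s e n) (P : V → Set) : Set where
    constructor split-at
    field
      {mid}     : V
      holds     : P mid
      {n₁ n₂}   : ℕ
      prefix    : Walk s mid n₁
      suffix    : Walk mid e n₂
      length≡   : n₁ + n₂ ≡ n
      prefix-⊆  : trace prefix ⊆ trace w
      suffix-⊆  : trace suffix ⊆ trace w
      ⊆-pieces  : ∀ {g} → g ∈ trace w → g ∈ trace prefix ⊎ g ∈ trace suffix

  split : ∀ {s e n} {P : V → Set} (w : Walk s e n) → Any P (vertices w) → Split w P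
  split []      (here p) = split-at p [] [] refl (λ m → m) (λ m → m) inj₁
  split (a ∷ w) (here p) = split-at p [] (a ∷ w) refl (λ { (here q) → here q }) (λ m → m) inj₂
  split (a ∷ w) (there x) with split w x
  ... | split-at p w₁ w₂ len ⊆₁ ⊆₂ pieces =
    split-at p (a ∷ w₁) w₂ (cong suc len)
      (λ { (here q) → here q ; (there m) → there (⊆₁ m) })
      (λ m → there (⊆₂ m))
      (λ { (here q) → inj₁ (here q) ; (there m) → Data.Sum.map₁ there (pieces m) })

  walk-of-linked : ∀ (x : V) mid (y : V) → Linked Adj (x ∷ mid ++ y ∷ []) →
    ∃[ w ] vertices {x} {y} {suc (length mid)} w ≡ x ∷ mid ++ y ∷ []
  walk-of-linked x []        y (a ∷ [-]) = (edge a ∷ []) , refl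
  walk-of-linked x (m ∷ mid) y (a ∷ l) with walk-of-linked m mid y l
  ... | w , eq = (edge a ∷ w) , cong (x ∷_) eq

  record LinkedPath (x y : V) (n : ℕ) (w : Walk x y (suc n)) : Set where
    field
      mid        : List V
      linked     : Linked Adj (x ∷ mid ++ y ∷ [])
      length≡    : length mid ≡ n
      vertices≡  : vertices w ≡ x ∷ mid ++ y ∷ []

  linked-of-walk : ∀ {x y n} (w : Walk x y (suc n)) → LinkedPath x y n w
  linked-of-walk (a ∷ []) = record { mid = [] ; linked = adj a ∷ [-] ; length≡ = refl ; vertices≡ = refl }
  linked-of-walk (_∷_ {x} {u} a (b ∷ w)) =
    record { mid = u ∷ mid ; linked = adj a ∷ linked ; length≡ = cong suc length≡ ; vertices≡ = cong (x ∷_) vertices≡ }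
    where open LinkedPath (linked-of-walk (b ∷ w))

  height : V → ℕ
  height v = r ∸ depth (proj₁ v)

  depth≤r : (v : V) → depth (proj₁ v) ≤ r
  depth≤r (inner _ _ , valid) = <⇒≤ valid
  depth≤r (leaf _ , valid)    = ≤-reflexive valid

  height-drop : ∀ (v : V) {p} (A : List (Fin t)) → length A ≡ r → p ≤ r → word (proj₁ v) ≡ drop p A → height v ≡ p
  height-drop v {p} A lA p≤r w≡ = begin
    r ∸ length (word (proj₁ v)) ≡⟨ cong (λ w → r ∸ length w) w≡ ⟩
    r ∸ length (drop p A)       ≡⟨ cong (r ∸_) (length-drop-≡ A lA p) ⟩
    r ∸ (r ∸ p)                 ≡⟨ m∸[m∸n]≡n p≤r ⟩
    p                           ∎
    where open ≡-Reasoning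

  height-leaf : (v : V) → IsQuasiLeaf v → height v ≡ 0
  height-leaf (leaf w , lw) tt = trans (cong (r ∸_) lw) (n∸n≡0 r)

  data Direction (s u : V) : Set where
    up   : ∀ b → proj₁ u ≡ inner b (drop 1 (word (proj₁ s))) → InCopyG b (proj₁ s) →
           height u ≡ suc (height s) → Direction s u
    down : height s ≡ suc (height u) → Direction s u

  direction : ∀ {s u} → Edge s u → Direction s u
  direction {_ , _}  {_ , vu} (edge (child-inner b w a))  = down (+-∸-assoc 1 (<⇒≤ vu))
  direction {_ , _}  {_ , vu} (edge (child-leaf b w a))   = down (+-∸-assoc 1 (≤-reflexive vu))
  direction {_ , vs} {_ , _}  (edge (parent-inner b w a)) = up b refl refl (+-∸-assoc 1 (<⇒≤ vs))
  direction {_ , vs} {_ , _}  (edge (parent-leaf b w a))  = up b refl tt (+-∸-assoc 1 (≤-reflexive vs))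

  height-lipschitz : ∀ {s e n} → Walk s e n → height e ≤ n + height s
  height-lipschitz []                    = ≤-refl
  height-lipschitz (_∷_ {n = n} a w) with direction a
  ... | up _ _ _ hu = ≤-trans (height-lipschitz w) (≤-reflexive (trans (cong (n +_) hu) (+-suc n _)))
  ... | down hs     = ≤-trans (height-lipschitz w) (+-mono-≤ (n≤1+n n) (≤-trans (n≤1+n _) (≤-reflexive (sym hs))))

  ancestors : Bool → List (Fin t) → ℕ → List (GV t)
  ancestors b w zero    = []
  ancestors b w (suc n) = inner b (drop 1 w) ∷ ancestors b (drop 1 w) n

  ∈-ancestors⁺ : ∀ {b w n i} → 1 ≤ i → i ≤ n → inner b (drop i w) ∈ ancestors b w n
  ∈-ancestors⁺ {i = suc zero} _ (s≤s _) = here refl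
  ∈-ancestors⁺ {b} {w} {suc n} {suc (suc i)} _ (s≤s i<n) =
    there (subst (λ z → inner b z ∈ ancestors b (drop 1 w) n) (drop-drop 1 (suc i) w) (∈-ancestors⁺ (s≤s z≤n) i<n))

  ∈-ancestors⁻ : ∀ {b w n g} → g ∈ ancestors b w n → ∃[ i ] 1 ≤ i × i ≤ n × g ≡ inner b (drop i w)
  ∈-ancestors⁻ {n = suc n} (here p) = 1 , ≤-refl , s≤s z≤n , p
  ∈-ancestors⁻ {b} {w} {suc n} (there m) with ∈-ancestors⁻ m
  ... | i , 1≤i , i≤n , eq = suc i , s≤s z≤n , s≤s i≤n , trans eq (cong (inner b) (drop-drop 1 i w))

  record Climb {s e n} (w : Walk s e n) : Set where
    field
      copy          : Bool
      trace≡        : trace w ≡ proj₁ s ∷ ancestors copy (word (proj₁ s)) n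
      start-in-copy : InCopyG copy (proj₁ s)
      end≡          : 1 ≤ n → proj₁ e ≡ inner copy (drop n (word (proj₁ s)))

  -- heights change by one along each edge, so every step of such a walk goes to the parent
  climb : ∀ {s e n} (w : Walk s e n) → n + height s ≤ height e → Climb w
  climb {s} [] _ = record
    { copy = copyOf (proj₁ s) ; trace≡ = refl ; start-in-copy = InCopyG-copyOf (proj₁ s) ; end≡ = λ () }
  climb (_∷_ {n = n} a w) tight with direction a
  ... | down hs = ⊥-elim (<-irrefl refl (≤-trans tight′ (height-lipschitz w)))
    where tight′ = ≤-trans (s≤s (+-monoʳ-≤ n (≤-trans (n≤1+n _) (≤-reflexive (sym hs))))) tight
  climb {s} {e} (_∷_ {u = u} {n = n} a w) tight | up b u≡ s∈b hu = record
    { copy          = b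
    ; trace≡        = cong (proj₁ s ∷_) (trans (Climb.trace≡ c)
                        (cong₂ (λ g β → g ∷ ancestors β (word g) n) u≡ copy≡))
    ; start-in-copy = s∈b
    ; end≡          = λ _ → end w (Climb.end≡ c)
    }
    where
      ws = word (proj₁ s)
      c = climb w (≤-trans (≤-reflexive (trans (cong (n +_) hu) (+-suc n _))) tight)
      copy≡ : Climb.copy c ≡ b
      copy≡ = sym (InCopyG-inner (Climb.start-in-copy c) u≡)
      end : ∀ {m} (w′ : Walk u e m) → (1 ≤ m → proj₁ e ≡ inner (Climb.copy c) (drop m (word (proj₁ u)))) →
            proj₁ e ≡ inner b (drop (suc m) ws)
      end []      _  = u≡
      end {suc m} (_ ∷ _) e≡ = trans (e≡ (s≤s z≤n))
        (cong₂ inner copy≡ (trans (cong (drop (suc m)) (cong word u≡)) (drop-drop 1 (suc m) ws)))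

  climb-visits : ∀ {s e n} {w : Walk s e n} (c : Climb w) {p i} (A : List (Fin t)) → word (proj₁ s) ≡ drop p A →
    p < i → i ≤ p + n → inner (Climb.copy c) (drop i A) ∈ trace w
  climb-visits {s = s} {n = n} {w = w} c {p} {i} A ws≡ p<i i≤p+n =
    subst (_ ∈_) (sym (Climb.trace≡ c)) (there (subst (λ z → inner β z ∈ ancestors β ws n) drop≡ visit))
    where
      β = Climb.copy c
      ws = word (proj₁ s)
      j = i ∸ p
      p+j≡i : p + j ≡ i
      p+j≡i = m+[n∸m]≡n (<⇒≤ p<i)
      drop≡ : drop j ws ≡ drop i A
      drop≡ = trans (cong (drop j) ws≡) (trans (drop-drop p j A) (cong (λ k → drop k A) p+j≡i))
      visit : inner β (drop j ws) ∈ ancestors β ws n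
      visit = ∈-ancestors⁺ (m<n⇒0<n∸m p<i) (+-cancelˡ-≤ p j n (subst (_≤ p + n) (sym p+j≡i) i≤p+n))

  climb-only : ∀ {s e n} {w : Walk s e n} (c : Climb w) {p g} (A : List (Fin t)) → word (proj₁ s) ≡ drop p A →
    g ∈ trace w → g ≡ proj₁ s ⊎ ∃[ i ] p < i × i ≤ p + n × g ≡ inner (Climb.copy c) (drop i A)
  climb-only c {p} A ws≡ m with subst (_ ∈_) (Climb.trace≡ c) m
  ... | here g≡ = inj₁ g≡
  ... | there m′ with ∈-ancestors⁻ m′
  ...   | j , 1≤j , j≤n , g≡ = inj₂ (p + j , subst (_≤ p + j) (+-comm p 1) (+-monoʳ-≤ p 1≤j) , +-monoʳ-≤ p j≤n ,
                                     trans g≡ (cong (inner _) (trans (cong (drop j) ws≡) (drop-drop p j A))))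

  copy-change-passes-leaf : ∀ {s e n b b′ ws we} (w : Walk s e n) → proj₁ s ≡ inner b ws → proj₁ e ≡ inner b′ we →
    b ≢ b′ → Any IsQuasiLeaf (vertices w)
  copy-change-passes-leaf [] s≡ e≡ b≢b′ = ⊥-elim (b≢b′ (proj₁ (inner-injective (trans (sym s≡) e≡))))
  copy-change-passes-leaf (_∷_ {u = (leaf _ , _)} a w) _ _ _ = there (head-Any w tt)
  copy-change-passes-leaf (_∷_ {u = (inner b″ _ , _)} a w) s≡ e≡ b≢b′ =
    there (copy-change-passes-leaf w refl e≡ λ b″≡b′ →
      b≢b′ (trans (AdjG-inner-copy (subst (λ g → AdjG g _) s≡ (adj a))) b″≡b′))

  -- drop j (word s) ≡ c ∷ a says that s lies in the subtree of the vertex with word c ∷ a;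
  -- a walk leaving that subtree passes through its parent, in one of the copies
  leaving-subtree : ∀ {s e n} (w : Walk s e n) (c : Fin t) (a : List (Fin t)) (j : ℕ) →
    drop j (word (proj₁ s)) ≡ c ∷ a → (∀ k → drop k (word (proj₁ e)) ≢ c ∷ a) →
    ∃[ β ] Any (λ v → proj₁ v ≡ inner β a) (vertices w)
  leaving-subtree []      c a j eq outside = ⊥-elim (outside j eq)
  leaving-subtree (x ∷ w) c a j eq outside with step (adj x) j eq
    where
      step : ∀ {g g′ : GV t} → AdjG g g′ → ∀ j → drop j (word g) ≡ c ∷ a →
             (∃[ β ] g′ ≡ inner β a) ⊎ (∃[ k ] drop k (word g′) ≡ c ∷ a)
      step (child-inner b w a′)  j       eq   = inj₂ (suc j , eq)
      step (child-leaf b w a′)   j       eq   = inj₂ (suc j , eq)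
      step (parent-inner b w a′) zero    refl = inj₁ (b , refl)
      step (parent-inner b w a′) (suc j) eq   = inj₂ (j , eq)
      step (parent-leaf b w a′)  zero    refl = inj₁ (b , refl)
      step (parent-leaf b w a′)  (suc j) eq   = inj₂ (j , eq)
  ... | inj₁ (β , at-a) = β , there (head-Any w at-a)
  ... | inj₂ (k , eq′)  = Data.Product.map₂ there (leaving-subtree w c a k eq′ outside)

  -- drop i A is the ancestor at height i of the quasi-leaf with word A
  Visits : Bool → List (Fin t) → ℕ → ℕ → ∀ {s e n} → Walk s e n → Set
  Visits β A l k w = ∀ i → l ≤ i → i ≤ k → inner β (drop i A) ∈ trace w

  Visits-≤ : ∀ {β A l k k′ s e n} {w : Walk s e n} → k′ ≤ k → Visits β A l k w → Visits β A l k′ w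
  Visits-≤ k′≤k vis i l≤i i≤k′ = vis i l≤i (≤-trans i≤k′ k′≤k)

  Visits-⊆ : ∀ {β A l k s e n s′ e′ n′} {w : Walk s e n} {w′ : Walk s′ e′ n′} →
    trace w ⊆ trace w′ → Visits β A l k w → Visits β A l k w′
  Visits-⊆ sub vis i l≤i i≤k = sub (vis i l≤i i≤k)

  Any-reverseʷ : ∀ {s e n} {P : V → Set} (w : Walk s e n) → Any P (vertices (reverseʷ w)) → Any P (vertices w)
  Any-reverseʷ w any = Any.reverse⁻ (subst (Any _) (vertices-reverseʷ w) any)

  inner-copy-≡ : ∀ {g : GV t} {β β′ L M} → g ≡ inner β L → g ≡ inner β′ M → β′ ≡ β
  inner-copy-≡ refl refl = refl

  climb-line : ∀ {s e n β p} (A : List (Fin t)) (w : Walk s e n) → proj₁ s ≡ inner β (drop p A) →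
    n + height s ≤ height e → Visits β A p (p + n) w
  climb-line {s} {β = β} {p} A w s≡ tight i p≤i i≤p+n with m≤n⇒m<n∨m≡n p≤i
  ... | inj₂ refl = subst (_∈ trace w) s≡ (start∈ w)
  ... | inj₁ p<i = subst (λ β′ → inner β′ (drop i A) ∈ trace w) copy≡ (climb-visits c A (cong word s≡) p<i i≤p+n)
    where
      c = climb w tight
      copy≡ : Climb.copy c ≡ β
      copy≡ = sym (InCopyG-inner (Climb.start-in-copy c) s≡)

  record LeafSplit {s e n} (w : Walk s e n) : Set where
    field
      leaf-split : Split w IsQuasiLeaf
    open Split leaf-split public
    field
      prefix-long : height s ≤ n₁
      suffix-long : height e ≤ n₂

  split-at-leaf : ∀ {s e n} (w : Walk s e n) → Any IsQuasiLeaf (vertices w) → LeafSplit w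
  split-at-leaf w any = record
    { leaf-split  = sp
    ; prefix-long = to-leaf (height-lipschitz (reverseʷ prefix))
    ; suffix-long = to-leaf (height-lipschitz suffix)
    }
    where
      sp = split w any
      open Split sp
      to-leaf : ∀ {a m} → a ≤ m + height mid → a ≤ m
      to-leaf {a} {m} le = subst (a ≤_) (+-identityʳ m) (subst (λ z → a ≤ m + z) (height-leaf mid holds) le)

  cross-copies-length : ∀ {s e n b b′ ws we} (w : Walk s e n) → proj₁ s ≡ inner b ws → proj₁ e ≡ inner b′ we →
    b ≢ b′ → height s + height e ≤ n
  cross-copies-length w s≡ e≡ b≢b′ = subst (_ ≤_) length≡ (+-mono-≤ prefix-long suffix-long)
    where open LeafSplit (split-at-leaf w (copy-change-passes-leaf w s≡ e≡ b≢b′))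

  -- such a walk descends from s to a quasi-leaf below e and climbs back up to e
  cross-copies-on-line : ∀ {s e n b b′ k l} (A : List (Fin t)) → length A ≡ r → (w : Walk s e n) →
    proj₁ s ≡ inner b (drop k A) → proj₁ e ≡ inner b′ (drop l A) → b ≢ b′ →
    1 ≤ l → l ≤ k → k ≤ r → n ≤ k + l → Visits b A l k w
  cross-copies-on-line {s} {e} {n} {b} {b′} {k} {l} A lA w s≡ e≡ b≢b′ 1≤l l≤k k≤r budget i l≤i i≤k =
    prefix-⊆ (reverseʷ-⊆ prefix (subst₂ (λ β z → inner β z ∈ trace (reverseʷ prefix)) copy≡ drop≡ visit))
    where
      open LeafSplit (split-at-leaf w (copy-change-passes-leaf w s≡ e≡ b≢b′))
      hs : height s ≡ k
      hs = height-drop s A lA k≤r (cong word s≡)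
      he : height e ≡ l
      he = height-drop e A lA (≤-trans l≤k k≤r) (cong word e≡)
      hz : height mid ≡ 0
      hz = height-leaf mid holds
      k≤n₁ : k ≤ n₁
      k≤n₁ = subst (_≤ n₁) hs prefix-long
      l≤n₂ : l ≤ n₂
      l≤n₂ = subst (_≤ n₂) he suffix-long
      tight = +-tight k≤n₁ l≤n₂ (subst (_≤ k + l) (sym length≡) budget)
      n₁≡k : n₁ ≡ k
      n₁≡k = ≤-antisym (proj₁ tight) k≤n₁
      n₂≡l : n₂ ≡ l
      n₂≡l = ≤-antisym (proj₂ tight) l≤n₂
      to-height : ∀ {m a} (v : V) → height v ≡ a → m ≡ a → m + height mid ≤ height v
      to-height {m} v hv m≡a = ≤-reflexive (trans (trans (cong (m +_) hz) (+-identityʳ m)) (trans m≡a (sym hv)))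
      c₁ = climb (reverseʷ prefix) (to-height s hs n₁≡k)
      c₂ = climb suffix (to-height e he n₂≡l)
      zw = word (proj₁ mid)
      copy≡ : Climb.copy c₁ ≡ b
      copy≡ = inner-copy-≡ s≡ (Climb.end≡ c₁ (≤-trans 1≤l (subst (l ≤_) (sym n₁≡k) l≤k)))
      line≡ : drop l zw ≡ drop l A
      line≡ = subst (λ m → drop m zw ≡ drop l A) n₂≡l
                (proj₂ (inner-injective (trans (sym (Climb.end≡ c₂ (subst (1 ≤_) (sym n₂≡l) 1≤l))) e≡)))
      drop≡ : drop i zw ≡ drop i A
      drop≡ = drop-agree l≤i line≡
      visit : inner (Climb.copy c₁) (drop i zw) ∈ trace (reverseʷ prefix)
      visit = climb-visits c₁ {p = 0} zw refl (≤-trans 1≤l l≤i) (subst (i ≤_) (sym n₁≡k) i≤k)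

  InCopyʷ : Bool → ∀ {s e n} → Walk s e n → Set
  InCopyʷ b w = ∀ {g} → g ∈ trace w → InCopyG b g

  CopyWalk : Bool → V → V → ℕ → Set
  CopyWalk b s e n = Σ (Walk s e n) (InCopyʷ b)

  cast : ∀ {b s s′ e e′ n n′} → s ≡ s′ → e ≡ e′ → n ≡ n′ → CopyWalk b s e n → CopyWalk b s′ e′ n′
  cast refl refl refl cw = cw

  stay : ∀ b (v : V) → InCopyG b (proj₁ v) → CopyWalk b v v 0
  stay b v v∈b = [] , λ { (here g≡) → subst (InCopyG b) (sym g≡) v∈b }

  reverseᶜ : ∀ {b s e n} → CopyWalk b s e n → CopyWalk b e s n
  reverseᶜ (w , inc) = reverseʷ w , λ m → inc (reverseʷ-⊆ w m)

  _++ᶜ_ : ∀ {b s u e m n} → CopyWalk b s u m → CopyWalk b u e n → CopyWalk b s e (m + n)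
  (w₁ , inc₁) ++ᶜ (w₂ , inc₂) = w₁ ++ʷ w₂ , go w₁ inc₁
    where
      go : ∀ {s m} (w : Walk s _ m) → InCopyʷ _ w → InCopyʷ _ (w ++ʷ w₂)
      go []      inc m         = inc₂ m
      go (a ∷ w) inc (here g≡) = inc (here g≡)
      go (a ∷ w) inc (there m) = go w (λ m′ → inc (there m′)) m

  parent-edge : ∀ {b} {s e : V} → InCopyG b (proj₁ s) → 1 ≤ depth (proj₁ s) →
    proj₁ e ≡ inner b (drop 1 (word (proj₁ s))) → Edge s e
  parent-edge {b} {inner .b (c ∷ L) , _} {_ , _} refl _ refl = edge (parent-inner b L c)
  parent-edge {b} {leaf (c ∷ L) , _}     {_ , _} tt   _ refl = edge (parent-leaf b L c)

  _∷ᶜ_ : ∀ {b s u e n} → InCopyG b (proj₁ s) × Edge s u → CopyWalk b u e n → CopyWalk b s e (suc n)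
  _∷ᶜ_ {b} (s∈b , a) (w , inc) = a ∷ w , λ { (here g≡) → subst (InCopyG b) (sym g≡) s∈b ; (there m) → inc m }

  ascend : ∀ b {s e : V} m → 1 ≤ m → m ≤ depth (proj₁ s) → InCopyG b (proj₁ s) →
    proj₁ e ≡ inner b (drop m (word (proj₁ s))) → CopyWalk b s e m
  ascend b {s} {e} (suc zero) _ 1≤d s∈b e≡ =
    (s∈b , parent-edge s∈b 1≤d e≡) ∷ᶜ stay b e (subst (InCopyG b) (sym e≡) refl)
  ascend b {s} {e} (suc (suc m)) _ m≤d s∈b e≡ =
    (s∈b , parent-edge s∈b (≤-trans (s≤s z≤n) m≤d) refl) ∷ᶜ
      ascend b {parent} {e} (suc m) (s≤s z≤n)
        (subst (suc m ≤_) (sym (length-drop 1 ws)) (∸-monoˡ-≤ 1 m≤d)) refl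
        (trans e≡ (cong (inner b) (sym (drop-drop 1 (suc m) ws))))
    where
      ws = word (proj₁ s)
      parent : V
      parent = inner b (drop 1 ws) , subst (_< r) (sym (length-drop 1 ws))
                 (<-≤-trans (∸-monoʳ-< {o = 0} (s≤s z≤n) (≤-trans (s≤s z≤n) m≤d)) (depth≤r s))

-- A and B are the words of two quasi-leaves whose paths to the root meet at height h = suc h′
module Fork {r t : ℕ} (A B : List (Fin t)) (lA : length A ≡ r) (lB : length B ≡ r)
  (h′ : ℕ) (h≤r : suc h′ ≤ r) (top : drop (suc h′) A ≡ drop (suc h′) B) (apart : drop h′ A ≢ drop h′ B) where
  open Walks {r} {t}

  h : ℕ
  h = suc h′

  private
    branch : ∃[ c ] drop h′ A ≡ c ∷ drop h A
    branch = drop-∷ A h′ (subst (h′ <_) (sym lA) h≤r)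

  in-A-branch : ∀ {p} → p ≤ h′ → drop (h′ ∸ p) (drop p A) ≡ proj₁ branch ∷ drop h A
  in-A-branch {p} p≤h′ = trans (drop-drop p (h′ ∸ p) A) (trans (cong (λ z → drop z A) (m+[n∸m]≡n p≤h′)) (proj₂ branch))

  B-outside-A-branch : ∀ k j → drop j (drop k B) ≢ proj₁ branch ∷ drop h A
  B-outside-A-branch k j eq = apart (sym (subst (λ z → drop z B ≡ drop h′ A) k+j≡h′ drop≡))
    where
      drop≡ : drop (k + j) B ≡ drop h′ A
      drop≡ = trans (sym (drop-drop k j B)) (trans eq (sym (proj₂ branch)))
      k+j≡h′ : k + j ≡ h′
      k+j≡h′ = ∸-cancelˡ (trans (sym (length-drop-≡ B lB (k + j))) (trans (cong length drop≡) (length-drop-≡ A lA h′))) h≤r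

  private
    height-A : ∀ (v : V) {p} → p ≤ r → word (proj₁ v) ≡ drop p A → height v ≡ p
    height-A v = height-drop v A lA
    height-B : ∀ (v : V) {p} → p ≤ r → word (proj₁ v) ≡ drop p B → height v ≡ p
    height-B v = height-drop v B lB
    h′≤r : h′ ≤ r
    h′≤r = ≤-trans (n≤1+n h′) h≤r

  record TopPath {s e n} (w : Walk s e n) (p q : ℕ) : Set where
    field
      copy          : Bool
      visits-A      : Visits copy A (suc p) h w
      visits-B      : Visits copy B (suc q) h w
      start-in-copy : InCopyG copy (proj₁ s)
      end-in-copy   : InCopyG copy (proj₁ e)
      only          : ∀ {g} → g ∈ trace w → g ≡ proj₁ s ⊎ g ≡ proj₁ e ⊎
                        (∃[ i ] p < i × i ≤ h × g ≡ inner copy (drop i A)) ⊎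
                        (∃[ i ] q < i × i ≤ h × g ≡ inner copy (drop i B))

  -- the walk leaves the branch of A through the fork, and the budget leaves no room for
  -- anything but a climb on either side of it
  top-path : ∀ {s e n p q} (w : Walk s e n) → word (proj₁ s) ≡ drop p A → word (proj₁ e) ≡ drop q B →
    p ≤ h′ → q ≤ h′ → n + p + q ≤ h + h → TopPath w p q
  top-path {s} {e} {n} {p} {q} w ws≡ we≡ p≤h′ q≤h′ budget = record
    { copy          = β
    ; visits-A      = λ i p<i i≤h → prefix-⊆ (subst (λ β′ → inner β′ (drop i A) ∈ trace prefix) copy₁≡
                        (climb-visits c₁ A ws≡ p<i (≤-trans i≤h (subst (h ≤_) (+-comm n₁ p) h≤n₁+p))))
    ; visits-B      = λ i q<i i≤h → suffix-⊆ (reverseʷ-⊆ suffix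
                        (subst (λ β′ → inner β′ (drop i B) ∈ trace (reverseʷ suffix)) copy₂≡
                        (climb-visits c₂ B we≡ q<i (≤-trans i≤h (subst (h ≤_) (+-comm n₂ q) h≤n₂+q)))))
    ; start-in-copy = subst (λ β′ → InCopyG β′ (proj₁ s)) copy₁≡ (Climb.start-in-copy c₁)
    ; end-in-copy   = subst (λ β′ → InCopyG β′ (proj₁ e)) copy₂≡ (Climb.start-in-copy c₂)
    ; only          = only
    }
    where
      crossing = leaving-subtree w (proj₁ branch) (drop h A) (h′ ∸ p) (trans (cong (drop (h′ ∸ p)) ws≡) (in-A-branch p≤h′))
                   (λ k eq → B-outside-A-branch q k (trans (cong (drop k) (sym we≡)) eq))
      β = proj₁ crossing
      open Split (split w (proj₂ crossing))
      hs : height s ≡ p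
      hs = height-A s (≤-trans p≤h′ h′≤r) ws≡
      he : height e ≡ q
      he = height-B e (≤-trans q≤h′ h′≤r) we≡
      hm : height mid ≡ h
      hm = height-A mid h≤r (cong word holds)
      h≤n₁+p : h ≤ n₁ + p
      h≤n₁+p = subst₂ (λ a b → a ≤ n₁ + b) hm hs (height-lipschitz prefix)
      h≤n₂+q : h ≤ n₂ + q
      h≤n₂+q = subst₂ (λ a b → a ≤ n₂ + b) hm he (height-lipschitz (reverseʷ suffix))
      tight = +-tight h≤n₁+p h≤n₂+q (subst (_≤ h + h) regroup budget)
        where
          regroup : n + p + q ≡ n₁ + p + (n₂ + q)
          regroup = trans (cong (λ m → m + p + q) (sym length≡)) (trans (+-interleave n₁ n₂ p q) (+-assoc (n₁ + p) n₂ q))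
      c₁ = climb prefix (subst₂ (λ a b → n₁ + a ≤ b) (sym hs) (sym hm) (proj₁ tight))
      c₂ = climb (reverseʷ suffix) (subst₂ (λ a b → n₂ + a ≤ b) (sym he) (sym hm) (proj₂ tight))
      copy₁≡ : Climb.copy c₁ ≡ β
      copy₁≡ = inner-copy-≡ holds (Climb.end≡ c₁ (positive (s≤s p≤h′) h≤n₁+p))
      copy₂≡ : Climb.copy c₂ ≡ β
      copy₂≡ = inner-copy-≡ holds (Climb.end≡ c₂ (positive (s≤s q≤h′) h≤n₂+q))
      Only : GV t → Set
      Only g = g ≡ proj₁ s ⊎ g ≡ proj₁ e ⊎
               (∃[ i ] p < i × i ≤ h × g ≡ inner β (drop i A)) ⊎ (∃[ i ] q < i × i ≤ h × g ≡ inner β (drop i B))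
      from-prefix : ∀ {g} → g ≡ proj₁ s ⊎ (∃[ i ] p < i × i ≤ p + n₁ × g ≡ inner (Climb.copy c₁) (drop i A)) → Only g
      from-prefix (inj₁ g≡) = inj₁ g≡
      from-prefix (inj₂ (i , p<i , i≤ , g≡)) =
        inj₂ (inj₂ (inj₁ (i , p<i , ≤-trans i≤ (subst (_≤ h) (+-comm n₁ p) (proj₁ tight)) , subst (λ β′ → _ ≡ inner β′ (drop i A)) copy₁≡ g≡)))
      from-suffix : ∀ {g} → g ≡ proj₁ e ⊎ (∃[ i ] q < i × i ≤ q + n₂ × g ≡ inner (Climb.copy c₂) (drop i B)) → Only g
      from-suffix (inj₁ g≡) = inj₂ (inj₁ g≡)
      from-suffix (inj₂ (i , q<i , i≤ , g≡)) =
        inj₂ (inj₂ (inj₂ (i , q<i , ≤-trans i≤ (subst (_≤ h) (+-comm n₂ q) (proj₂ tight)) , subst (λ β′ → _ ≡ inner β′ (drop i B)) copy₂≡ g≡)))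
      only : ∀ {g} → g ∈ trace w → Only g
      only m = Data.Sum.[ from-prefix ∘ climb-only c₁ A ws≡ , from-suffix ∘ climb-only c₂ B we≡ ∘ ⊆-reverseʷ suffix ]′ (⊆-pieces m)

  private
    cross-via-start-copy : ∀ {s e n b b′ k l} (w : Walk s e n) → proj₁ s ≡ inner b (drop k B) → proj₁ e ≡ inner b′ (drop l A) →
      b ≢ b′ → 1 ≤ l → k ≤ h → l ≤ h → n + k + l ≤ h + h + (k ⊓ l + k ⊓ l) →
      Any (λ v → proj₁ v ≡ inner b (drop h A)) (vertices w) → l ≤ k × Visits b B k h w × Visits b A l h w
    cross-via-start-copy {s} {e} {n} {b} {b′} {k} {l} w s≡ e≡ b≢b′ 1≤l k≤h l≤h budget at-fork =
      ≤-trans l≤m (m⊓n≤m k l) , visits-B , visits-A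
      where
        open Split (split w at-fork)
        m = k ⊓ l
        hs = height-B s (≤-trans k≤h h≤r) (cong word s≡)
        he = height-A e (≤-trans l≤h h≤r) (cong word e≡)
        hm = height-A mid h≤r (cong word holds)
        h≤n₁+k : h ≤ n₁ + k
        h≤n₁+k = subst₂ (λ a c → a ≤ n₁ + c) hm hs (height-lipschitz prefix)
        h+l≤n₂ : h + l ≤ n₂
        h+l≤n₂ = subst₂ (λ a c → a + c ≤ n₂) hm he (cross-copies-length suffix holds e≡ b≢b′)
        bounds : l ≤ m × n₁ + k ≤ h × n₂ ≤ h + l
        bounds = cross-budget h≤n₁+k h+l≤n₂
                   (subst (_≤ h + h + (m + m)) (trans (cong (λ z → z + k + l) (sym length≡)) (+-interleave n₁ n₂ k l)) budget)
                   (m⊓n≤n k l)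
        l≤m = proj₁ bounds
        visits-B : Visits b B k h w
        visits-B = Visits-⊆ prefix-⊆ (Visits-≤ (subst (h ≤_) (+-comm n₁ k) h≤n₁+k)
                     (climb-line B prefix s≡ (subst₂ (λ a c → n₁ + a ≤ c) (sym hs) (sym hm) (proj₁ (proj₂ bounds)))))
        visits-A : Visits b A l h w
        visits-A = Visits-⊆ suffix-⊆ (cross-copies-on-line A lA suffix holds e≡ b≢b′ 1≤l l≤h h≤r (proj₂ (proj₂ bounds)))

    cross-via-end-copy : ∀ {s e n b b′ k l} (w : Walk s e n) → proj₁ s ≡ inner b (drop k B) → proj₁ e ≡ inner b′ (drop l A) →
      b ≢ b′ → 1 ≤ k → k ≤ h → l ≤ h → n + k + l ≤ h + h + (k ⊓ l + k ⊓ l) →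
      Any (λ v → proj₁ v ≡ inner b′ (drop h A)) (vertices w) → k ≤ l × Visits b′ B k h w × Visits b′ A l h w
    cross-via-end-copy {s} {e} {n} {b} {b′} {k} {l} w s≡ e≡ b≢b′ 1≤k k≤h l≤h budget at-fork =
      ≤-trans k≤m (m⊓n≤n k l) , visits-B , visits-A
      where
        open Split (split w at-fork)
        m = k ⊓ l
        hs = height-B s (≤-trans k≤h h≤r) (cong word s≡)
        he = height-A e (≤-trans l≤h h≤r) (cong word e≡)
        hm = height-A mid h≤r (cong word holds)
        mid≡ : proj₁ mid ≡ inner b′ (drop h B)
        mid≡ = trans holds (cong (inner b′) top)
        h≤n₂+l : h ≤ n₂ + l
        h≤n₂+l = subst₂ (λ a c → a ≤ n₂ + c) hm he (height-lipschitz (reverseʷ suffix))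
        h+k≤n₁ : h + k ≤ n₁
        h+k≤n₁ = subst₂ (λ a c → a + c ≤ n₁) hm hs
                   (subst (_≤ n₁) (+-comm (height s) (height mid)) (cross-copies-length prefix s≡ mid≡ b≢b′))
        bounds : k ≤ m × n₂ + l ≤ h × n₁ ≤ h + k
        bounds = cross-budget h≤n₂+l h+k≤n₁
                   (subst (_≤ h + h + (m + m)) (trans (cong (λ z → z + k + l) (sym length≡)) (+-interleave′ n₁ n₂ k l)) budget)
                   (m⊓n≤m k l)
        k≤m = proj₁ bounds
        visits-B : Visits b′ B k h w
        visits-B = Visits-⊆ (λ m → prefix-⊆ (reverseʷ-⊆ prefix m))
                     (cross-copies-on-line B lB (reverseʷ prefix) mid≡ s≡ (≢-sym b≢b′) 1≤k k≤h h≤r (proj₂ (proj₂ bounds)))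
        visits-A : Visits b′ A l h w
        visits-A = Visits-⊆ (λ m → suffix-⊆ (reverseʷ-⊆ suffix m)) (Visits-≤ (subst (h ≤_) (+-comm n₂ l) h≤n₂+l)
                     (climb-line A (reverseʷ suffix) e≡ (subst₂ (λ a c → n₂ + a ≤ c) (sym he) (sym hm) (proj₁ (proj₂ bounds)))))

  -- the walk passes the fork in one of the copies and changes copies below its lower end
  opposite-cross : ∀ {s e n b b′ k l} (w : Walk s e n) → proj₁ s ≡ inner b (drop k B) → proj₁ e ≡ inner b′ (drop l A) →
    b ≢ b′ → 1 ≤ k → k ≤ h → 1 ≤ l → l ≤ h′ → n + k + l ≤ h + h + (k ⊓ l + k ⊓ l) →
    (l ≤ k × Visits b B k h w × Visits b A l h w) ⊎ (k ≤ l × Visits b′ B k h w × Visits b′ A l h w)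
  opposite-cross {b = b} {b′} {k} {l} w s≡ e≡ b≢b′ 1≤k k≤h 1≤l l≤h′ budget = by-fork-copy (β Data.Bool.≟ b)
    where
      crossing = leaving-subtree (reverseʷ w) (proj₁ branch) (drop h A) (h′ ∸ l)
                   (trans (cong (λ z → drop (h′ ∸ l) (word z)) e≡) (in-A-branch l≤h′))
                   (λ j eq → B-outside-A-branch k j (trans (cong (λ z → drop j (word z)) (sym s≡)) eq))
      β = proj₁ crossing
      at-fork : ∀ {c} → β ≡ c → Any (λ v → proj₁ v ≡ inner c (drop h A)) (vertices w)
      at-fork refl = Any-reverseʷ w (proj₂ crossing)
      l≤h = ≤-trans l≤h′ (n≤1+n h′)
      by-fork-copy : Dec (β ≡ b) →
        (l ≤ k × Visits b B k h w × Visits b A l h w) ⊎ (k ≤ l × Visits b′ B k h w × Visits b′ A l h w)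
      by-fork-copy (yes β≡b) = inj₁ (cross-via-start-copy w s≡ e≡ b≢b′ 1≤l k≤h l≤h budget (at-fork β≡b))
      by-fork-copy (no  β≢b) = inj₂ (cross-via-end-copy w s≡ e≡ b≢b′ 1≤k k≤h l≤h budget
                                 (at-fork (trans (¬-not β≢b) (sym (¬-not (≢-sym b≢b′))))))

-- X and Y are the words of the quasi-leaves x and y, whose paths to the root meet at height h = suc h′
module Cycle {r t : ℕ} (X Y : List (Fin t)) (lX : length X ≡ r) (lY : length Y ≡ r)
  (h′ : ℕ) (h≤r : suc h′ ≤ r) (top : drop (suc h′) X ≡ drop (suc h′) Y) (apart : drop h′ X ≢ drop h′ Y) where
  open Walks {r} {t}
  module FX = Fork X Y lX lY h′ h≤r top apart
  module FY = Fork Y X lY lX h′ h≤r (sym top) (λ eq → apart (sym eq))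

  h : ℕ
  h = suc h′

  -- d(x, y), the length of each half of C_{x,y}
  dxy : ℕ
  dxy = h + h

  dxy∸h : dxy ∸ h ≡ h
  dxy∸h = m+n∸n≡m h h

  h<dxy : h < dxy
  h<dxy = s≤s (m≤n+m h h′)

  mirror≤h : ∀ {p} → h ≤ p → dxy ∸ p ≤ h
  mirror≤h h≤p = ≤-trans (∸-monoʳ-≤ dxy h≤p) (≤-reflexive dxy∸h)

  mirror<h : ∀ {p} → h < p → p ≤ dxy → dxy ∸ p ≤ h′
  mirror<h {p} h<p p≤dxy = ≤-pred (subst (dxy ∸ p <_) dxy∸h (∸-monoʳ-< h<p p≤dxy))

  pos-word : ℕ → List (Fin t)
  pos-word p with p ≤? h
  ... | yes _ = drop p X
  ... | no  _ = drop (dxy ∸ p) Y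

  -- the vertex at position p ∈ [0, dxy] of P_{x,y} (b = false) or of P′_{x,y} (b = true):
  -- at height p above x for p ≤ h, at height dxy ∸ p above y for p ≥ h
  cyc : Bool → ℕ → GV t
  cyc b zero = leaf X
  cyc b (suc p) with suc p ≟ dxy
  ... | yes _ = leaf Y
  ... | no  _ = inner b (pos-word (suc p))

  pos-word-X : ∀ {p} → p ≤ h → pos-word p ≡ drop p X
  pos-word-X {p} p≤h with p ≤? h
  ... | yes _   = refl
  ... | no  p≰h = ⊥-elim (p≰h p≤h)

  pos-word-Y : ∀ {p} → h ≤ p → pos-word p ≡ drop (dxy ∸ p) Y
  pos-word-Y {p} h≤p with p ≤? h
  ... | yes p≤h rewrite ≤-antisym p≤h h≤p = trans top (cong (λ z → drop z Y) (sym dxy∸h))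
  ... | no  _   = refl

  cyc-inner : ∀ {b p} → 0 < p → p < dxy → cyc b p ≡ inner b (pos-word p)
  cyc-inner {b} {suc p} _ p<dxy with suc p ≟ dxy
  ... | yes p≡dxy = ⊥-elim (<-irrefl p≡dxy p<dxy)
  ... | no  _     = refl

  cyc-X : ∀ {b p} → 0 < p → p ≤ h → cyc b p ≡ inner b (drop p X)
  cyc-X 0<p p≤h = trans (cyc-inner 0<p (≤-<-trans p≤h h<dxy)) (cong (inner _) (pos-word-X p≤h))

  cyc-Y : ∀ {b p} → h ≤ p → p < dxy → cyc b p ≡ inner b (drop (dxy ∸ p) Y)
  cyc-Y h≤p p<dxy = trans (cyc-inner (<-≤-trans (s≤s z≤n) h≤p) p<dxy) (cong (inner _) (pos-word-Y h≤p))

  cyc-y : ∀ {b} → cyc b dxy ≡ leaf Y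
  cyc-y with dxy ≟ dxy
  ... | yes _ = refl
  ... | no  n = ⊥-elim (n refl)

  word-cyc-X : ∀ {b p} → p ≤ h → word (cyc b p) ≡ drop p X
  word-cyc-X {p = zero}  _   = refl
  word-cyc-X {p = suc p} p≤h = cong word (cyc-X (s≤s z≤n) p≤h)

  word-cyc-Y : ∀ {b p} → h ≤ p → p ≤ dxy → word (cyc b p) ≡ drop (dxy ∸ p) Y
  word-cyc-Y {b} {p} h≤p p≤dxy with m≤n⇒m<n∨m≡n p≤dxy
  ... | inj₁ p<dxy = cong word (cyc-Y h≤p p<dxy)
  ... | inj₂ refl  = trans (cong word (cyc-y {b})) (cong (λ z → drop z Y) (sym (n∸n≡0 dxy)))

  cyc-in-copy : ∀ b p → InCopyG b (cyc b p)
  cyc-in-copy b zero = tt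
  cyc-in-copy b (suc p) with suc p ≟ dxy
  ... | yes _ = tt
  ... | no  _ = refl

  private
    drop-short : ∀ (L : List (Fin t)) → length L ≡ r → ∀ {k} → 0 < k → k ≤ r → length (drop k L) < r
    drop-short L lL {k} 0<k k≤r = subst (_< r) (sym (length-drop-≡ L lL k)) (∸-monoʳ-< 0<k k≤r)

  pos-word-short : ∀ {p} → 0 < p → p < dxy → length (pos-word p) < r
  pos-word-short {p} 0<p p<dxy = Data.Sum.[ on-X , on-Y ]′ (≤-total p h)
    where
      on-X : p ≤ h → length (pos-word p) < r
      on-X p≤h = subst (λ w → length w < r) (sym (pos-word-X p≤h)) (drop-short X lX 0<p (≤-trans p≤h h≤r))
      on-Y : h ≤ p → length (pos-word p) < r
      on-Y h≤p = subst (λ w → length w < r) (sym (pos-word-Y h≤p))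
                   (drop-short Y lY (m<n⇒0<n∸m p<dxy) (≤-trans (mirror≤h h≤p) h≤r))

  Valid-cyc : ∀ b p → p ≤ dxy → Valid r (cyc b p)
  Valid-cyc b zero    _ = lX
  Valid-cyc b (suc p) p≤dxy with suc p ≟ dxy
  ... | yes _     = lY
  ... | no  p≢dxy = pos-word-short (s≤s z≤n) (≤∧≢⇒< p≤dxy p≢dxy)

  cycV : Bool → (p : ℕ) → p ≤ dxy → V
  cycV b p p≤dxy = cyc b p , Valid-cyc b p p≤dxy

  -- the height of position p
  ht : ℕ → ℕ
  ht p = p ⊓ (dxy ∸ p)

  ht-X : ∀ {p} → p ≤ h → ht p ≡ p
  ht-X {p} p≤h = m≤n⇒m⊓n≡m (≤-trans p≤h (subst (_≤ dxy ∸ p) dxy∸h (∸-monoʳ-≤ dxy p≤h)))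

  ht-Y : ∀ {p} → h ≤ p → ht p ≡ dxy ∸ p
  ht-Y h≤p = m≥n⇒m⊓n≡n (≤-trans (mirror≤h h≤p) h≤p)

  arc-X : ∀ b {p p′} (p≤ : p ≤ dxy) (p′≤ : p′ ≤ dxy) → p ≤ p′ → p′ ≤ h →
    CopyWalk b (cycV b p p≤) (cycV b p′ p′≤) (p′ ∸ p)
  arc-X b {p} {p′} p≤ p′≤ p≤p′ p′≤h with m≤n⇒m<n∨m≡n p≤p′
  ... | inj₂ refl = cast refl (vertex-≡ refl) (sym (n∸n≡0 p)) (stay b _ (cyc-in-copy b p))
  ... | inj₁ p<p′ = ascend b (p′ ∸ p) (m<n⇒0<n∸m p<p′) depth-ok (cyc-in-copy b p) end≡
    where
      depth-ok : p′ ∸ p ≤ depth (cyc b p)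
      depth-ok = subst (p′ ∸ p ≤_) (sym (trans (cong length (word-cyc-X (≤-trans p≤p′ p′≤h))) (length-drop-≡ X lX p)))
                   (∸-monoˡ-≤ p (≤-trans p′≤h h≤r))
      end≡ : cyc b p′ ≡ inner b (drop (p′ ∸ p) (word (cyc b p)))
      end≡ = trans (cyc-X (≤-<-trans z≤n p<p′) p′≤h) (cong (inner b) (sym (begin
        drop (p′ ∸ p) (word (cyc b p)) ≡⟨ cong (drop (p′ ∸ p)) (word-cyc-X (≤-trans p≤p′ p′≤h)) ⟩
        drop (p′ ∸ p) (drop p X)       ≡⟨ drop-drop p (p′ ∸ p) X ⟩
        drop (p + (p′ ∸ p)) X          ≡⟨ cong (λ z → drop z X) (m+[n∸m]≡n p≤p′) ⟩
        drop p′ X                      ∎)))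
        where open ≡-Reasoning

  arc-Y : ∀ b {s s′} (s≤ : s ≤ dxy) (s′≤ : s′ ≤ dxy) → h ≤ s′ → s′ ≤ s →
    CopyWalk b (cycV b s s≤) (cycV b s′ s′≤) (s ∸ s′)
  arc-Y b {s} {s′} s≤ s′≤ h≤s′ s′≤s with m≤n⇒m<n∨m≡n s′≤s
  ... | inj₂ refl = cast refl (vertex-≡ refl) (sym (n∸n≡0 s)) (stay b _ (cyc-in-copy b s))
  ... | inj₁ s′<s = ascend b (s ∸ s′) (m<n⇒0<n∸m s′<s) depth-ok (cyc-in-copy b s) end≡
    where
      open ≡-Reasoning
      mirror-split : (dxy ∸ s) + (s ∸ s′) ≡ dxy ∸ s′
      mirror-split = trans (+-comm (dxy ∸ s) (s ∸ s′)) (∸-split s′≤s s≤)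
      depth-ok : s ∸ s′ ≤ depth (cyc b s)
      depth-ok = subst (s ∸ s′ ≤_)
                   (sym (trans (cong length (word-cyc-Y (≤-trans h≤s′ s′≤s) s≤)) (length-drop-≡ Y lY (dxy ∸ s))))
                   (m+n≤o⇒m≤o∸n (s ∸ s′) (subst (_≤ r) (sym (trans (+-comm (s ∸ s′) (dxy ∸ s)) mirror-split))
                     (≤-trans (mirror≤h h≤s′) h≤r)))
      end≡ : cyc b s′ ≡ inner b (drop (s ∸ s′) (word (cyc b s)))
      end≡ = trans (cyc-Y h≤s′ (<-≤-trans s′<s s≤)) (cong (inner b) (sym (begin
        drop (s ∸ s′) (word (cyc b s))  ≡⟨ cong (drop (s ∸ s′)) (word-cyc-Y (≤-trans h≤s′ s′≤s) s≤) ⟩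
        drop (s ∸ s′) (drop (dxy ∸ s) Y) ≡⟨ drop-drop (dxy ∸ s) (s ∸ s′) Y ⟩
        drop ((dxy ∸ s) + (s ∸ s′)) Y   ≡⟨ cong (λ z → drop z Y) mirror-split ⟩
        drop (dxy ∸ s′) Y               ∎)))

  arc-ordered : ∀ b {p s} (p≤ : p ≤ dxy) (s≤ : s ≤ dxy) → p ≤ s → CopyWalk b (cycV b p p≤) (cycV b s s≤) (s ∸ p)
  arc-ordered b {p} {s} p≤ s≤ p≤s with s ≤? h | h ≤? p
  ... | yes s≤h | _       = arc-X b p≤ s≤ p≤s s≤h
  ... | no  _   | yes h≤p = reverseᶜ (arc-Y b s≤ p≤ h≤p p≤s)
  ... | no  s≰h | no  h≰p =
    cast refl refl (∸-split p≤h h≤s)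
      (arc-X b p≤ (<⇒≤ h<dxy) p≤h ≤-refl ++ᶜ reverseᶜ (arc-Y b s≤ (<⇒≤ h<dxy) ≤-refl h≤s))
    where
      p≤h = <⇒≤ (≰⇒> h≰p)
      h≤s = <⇒≤ (≰⇒> s≰h)

  arc : ∀ b {p q} (p≤ : p ≤ dxy) (q≤ : q ≤ dxy) → CopyWalk b (cycV b p p≤) (cycV b q q≤) ∣ p - q ∣
  arc b {p} {q} p≤ q≤ with ≤-total p q
  ... | inj₁ p≤q = cast refl refl (sym (m≤n⇒∣m-n∣≡n∸m p≤q)) (arc-ordered b p≤ q≤ p≤q)
  ... | inj₂ q≤p = cast refl refl (sym (m≤n⇒∣n-m∣≡n∸m q≤p)) (reverseᶜ (arc-ordered b q≤ p≤ q≤p))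

  -- the distance along C_{x,y} between position p of one half and position q of the other
  detour : ℕ → ℕ → ℕ
  detour p q = ∣ p - q ∣ + (ht p ⊓ ht q + ht p ⊓ ht q)

  record NearestLeaf (q : ℕ) : Set where
    field
      pos     : ℕ
      pos≤    : pos ≤ dxy
      leaf≡   : ∀ b b′ → cycV b pos pos≤ ≡ cycV b′ pos pos≤
      ∣q-pos∣ : ∣ q - pos ∣ ≡ ht q

  nearest-leaf : ∀ q → q ≤ dxy → NearestLeaf q
  nearest-leaf q q≤ with q ≤? h
  ... | yes q≤h = record
    { pos = 0 ; pos≤ = z≤n ; leaf≡ = λ _ _ → vertex-≡ refl
    ; ∣q-pos∣ = trans (∣-∣-identityʳ q) (sym (ht-X q≤h)) }
  ... | no  q≰h = record
    { pos = dxy ; pos≤ = ≤-refl ; leaf≡ = λ b b′ → vertex-≡ (trans (cyc-y {b}) (sym (cyc-y {b′})))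
    ; ∣q-pos∣ = trans (m≤n⇒∣m-n∣≡n∸m q≤) (sym (ht-Y (<⇒≤ (≰⇒> q≰h)))) }

  -- go down to a leaf below the lower of the two ends and come back up in the other copy
  cross-walk : ∀ b b′ {p q} (p≤ : p ≤ dxy) (q≤ : q ≤ dxy) → Walk (cycV b p p≤) (cycV b′ q q≤) (detour p q)
  cross-walk b b′ {p} {q} p≤ q≤ with ≤-total (ht q) (ht p)
  ... | inj₁ hq≤hp = subst (Walk _ _) length≡
          (proj₁ (arc b p≤ q≤) ++ʷ proj₁ (arc b q≤ pos≤) ++ʷ
             subst (λ v → Walk v _ _) (leaf≡ b′ b) (proj₁ (arc b′ pos≤ q≤)))
    where
      open NearestLeaf (nearest-leaf q q≤)
      length≡ : ∣ p - q ∣ + (∣ q - pos ∣ + ∣ pos - q ∣) ≡ detour p q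
      length≡ = cong (∣ p - q ∣ +_) (trans (cong₂ _+_ ∣q-pos∣ (trans (∣-∣-comm pos q) ∣q-pos∣))
                  (cong (λ m → m + m) (sym (m≥n⇒m⊓n≡n hq≤hp))))
  ... | inj₂ hp≤hq = subst (Walk _ _) length≡
          (proj₁ (arc b p≤ pos≤) ++ʷ subst (λ v → Walk v _ _) (leaf≡ b′ b) (proj₁ (arc b′ pos≤ p≤)) ++ʷ
             proj₁ (arc b′ p≤ q≤))
    where
      open NearestLeaf (nearest-leaf p p≤)
      length≡ : ∣ p - pos ∣ + (∣ pos - p ∣ + ∣ p - q ∣) ≡ detour p q
      length≡ = trans (sym (+-assoc ∣ p - pos ∣ ∣ pos - p ∣ ∣ p - q ∣))
                  (trans (+-comm (∣ p - pos ∣ + ∣ pos - p ∣) ∣ p - q ∣)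
                    (cong (∣ p - q ∣ +_) (trans (cong₂ _+_ ∣q-pos∣ (trans (∣-∣-comm pos p) ∣q-pos∣))
                      (cong (λ m → m + m) (sym (m≤n⇒m⊓n≡m hp≤hq))))))

  cyc-X∈ : ∀ {β x s e n} {w : Walk s e n} → 0 < x → x ≤ h → inner β (drop x X) ∈ trace w → cyc β x ∈ trace w
  cyc-X∈ {w = w} 0<x x≤h = subst (_∈ trace w) (sym (cyc-X 0<x x≤h))

  cyc-Y∈ : ∀ {β x s e n} {w : Walk s e n} → h ≤ x → x < dxy → inner β (drop (dxy ∸ x) Y) ∈ trace w → cyc β x ∈ trace w
  cyc-Y∈ {w = w} h≤x x<dxy = subst (_∈ trace w) (sym (cyc-Y h≤x x<dxy))

  height-X : ∀ {b p} (v : V) → proj₁ v ≡ cyc b p → p ≤ h → height v ≡ p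
  height-X v v≡ p≤h = height-drop v X lX (≤-trans p≤h h≤r) (trans (cong word v≡) (word-cyc-X p≤h))

  height-Y : ∀ {b p} (v : V) → proj₁ v ≡ cyc b p → h ≤ p → p ≤ dxy → height v ≡ dxy ∸ p
  height-Y v v≡ h≤p p≤dxy = height-drop v Y lY (≤-trans (mirror≤h h≤p) h≤r) (trans (cong word v≡) (word-cyc-Y h≤p p≤dxy))

  mirror-budget : ∀ {n p q} → p ≤ q → q ≤ dxy → n + p ≤ q → n + (dxy ∸ q) ≤ dxy ∸ p
  mirror-budget {n} {p} {q} p≤q q≤dxy budget =
    subst (n + (dxy ∸ q) ≤_) (∸-split p≤q q≤dxy) (+-monoˡ-≤ (dxy ∸ q) (m+n≤o⇒m≤o∸n n budget))

  between-X : ∀ {s e n b β p q} (w : Walk s e n) → proj₁ s ≡ cyc b p → proj₁ e ≡ cyc β q → p < q → q ≤ h →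
    n + p ≤ q → ∀ x → p < x → x < q → cyc β x ∈ trace w
  between-X {s} {e} {n} {b} {β} {p} {q} w s≡ e≡ p<q q≤h budget x p<x x<q =
    cyc-X∈ (≤-<-trans z≤n p<x) (≤-trans (<⇒≤ x<q) q≤h) (subst (λ β′ → inner β′ (drop x X) ∈ trace w) copy≡ visit)
    where
      hs = height-X s s≡ (≤-trans (<⇒≤ p<q) q≤h)
      he = height-X e e≡ q≤h
      c = climb w (subst₂ (λ a c → n + a ≤ c) (sym hs) (sym he) budget)
      q≤n+p : q ≤ n + p
      q≤n+p = subst₂ (λ a c → a ≤ n + c) he hs (height-lipschitz w)
      copy≡ : Climb.copy c ≡ β
      copy≡ = inner-copy-≡ (trans e≡ (cyc-X (≤-<-trans z≤n p<q) q≤h)) (Climb.end≡ c (positive p<q q≤n+p))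
      visit = climb-visits c X (trans (cong word s≡) (word-cyc-X (≤-trans (<⇒≤ p<q) q≤h))) p<x
                (≤-trans (<⇒≤ x<q) (subst (q ≤_) (+-comm n p) q≤n+p))

  between-Y : ∀ {s e n β b′ p q} (w : Walk s e n) → proj₁ s ≡ cyc β p → proj₁ e ≡ cyc b′ q → h ≤ p → p < q → q ≤ dxy →
    n + p ≤ q → ∀ x → p < x → x < q → cyc β x ∈ trace w
  between-Y {s} {e} {n} {β} {b′} {p} {q} w s≡ e≡ h≤p p<q q≤dxy budget x p<x x<q =
    cyc-Y∈ (≤-trans h≤p (<⇒≤ p<x)) (<-≤-trans x<q q≤dxy)
      (reverseʷ-⊆ w (subst (λ β′ → inner β′ (drop (dxy ∸ x) Y) ∈ trace (reverseʷ w)) copy≡ visit))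
    where
      p<dxy = <-≤-trans p<q q≤dxy
      hs = height-Y s s≡ h≤p (<⇒≤ p<dxy)
      he = height-Y e e≡ (≤-trans h≤p (<⇒≤ p<q)) q≤dxy
      c = climb (reverseʷ w) (subst₂ (λ a c → n + a ≤ c) (sym he) (sym hs) (mirror-budget (<⇒≤ p<q) q≤dxy budget))
      hs≤ : dxy ∸ p ≤ n + (dxy ∸ q)
      hs≤ = subst₂ (λ a c → a ≤ n + c) hs he (height-lipschitz (reverseʷ w))
      copy≡ : Climb.copy c ≡ β
      copy≡ = inner-copy-≡ (trans s≡ (cyc-Y h≤p p<dxy)) (Climb.end≡ c (positive (∸-monoʳ-< p<q q≤dxy) hs≤))
      visit = climb-visits c Y (trans (cong word e≡) (word-cyc-Y (≤-trans h≤p (<⇒≤ p<q)) q≤dxy))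
                (∸-monoʳ-< x<q q≤dxy) (≤-trans (∸-monoʳ-≤ dxy (<⇒≤ p<x)) (subst (dxy ∸ p ≤_) (+-comm n (dxy ∸ q)) hs≤))

  top-cover : ∀ {s e n p q} {w : Walk s e n} (tp : FX.TopPath w p (dxy ∸ q)) → q ≤ dxy →
    ∀ x → p < x → x < q → cyc (FX.TopPath.copy tp) x ∈ trace w
  top-cover {p = p} {q} tp q≤dxy x p<x x<q with x ≤? h
  ... | yes x≤h = cyc-X∈ (≤-<-trans z≤n p<x) x≤h (FX.TopPath.visits-A tp x p<x x≤h)
  ... | no  x≰h = cyc-Y∈ (<⇒≤ (≰⇒> x≰h)) (<-≤-trans x<q q≤dxy)
                    (FX.TopPath.visits-B tp (dxy ∸ x) (∸-monoʳ-< x<q q≤dxy) (mirror≤h (<⇒≤ (≰⇒> x≰h))))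

  over-top : ∀ {s e n b b′ p q} (w : Walk s e n) → proj₁ s ≡ cyc b p → proj₁ e ≡ cyc b′ q → p < h → h < q → q ≤ dxy →
    n + p ≤ q → FX.TopPath w p (dxy ∸ q)
  over-top {s} {e} {n} {p = p} {q} w s≡ e≡ p<h h<q q≤dxy budget =
    FX.top-path w (trans (cong word s≡) (word-cyc-X (<⇒≤ p<h))) (trans (cong word e≡) (word-cyc-Y (<⇒≤ h<q) q≤dxy))
      (≤-pred p<h) (mirror<h h<q q≤dxy)
      (≤-trans (+-monoˡ-≤ (dxy ∸ q) budget) (≤-reflexive (m+[n∸m]≡n q≤dxy)))

  between-on-half : ∀ {s e n β p q} (w : Walk s e n) → proj₁ s ≡ cyc β p → proj₁ e ≡ cyc β q → p < q → q ≤ dxy →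
    0 < p ⊎ q < dxy → n + p ≤ q → ∀ x → p < x → x < q → cyc β x ∈ trace w
  between-on-half {β = β} {p} {q} w s≡ e≡ p<q q≤dxy inner-end budget with q ≤? h | h ≤? p
  ... | yes q≤h | _       = between-X w s≡ e≡ p<q q≤h budget
  ... | no  _   | yes h≤p = between-Y w s≡ e≡ h≤p p<q q≤dxy budget
  ... | no  q≰h | no  h≰p = subst (λ c → ∀ x → p < x → x < q → cyc c x ∈ trace w) copy≡ (top-cover tp q≤dxy)
    where
      p<h = ≰⇒> h≰p
      h<q = ≰⇒> q≰h
      tp = over-top w s≡ e≡ p<h h<q q≤dxy budget
      copy≡ : FX.TopPath.copy tp ≡ β
      copy≡ = sym (Data.Sum.[ (λ 0<p → InCopyG-inner (FX.TopPath.start-in-copy tp) (trans s≡ (cyc-X 0<p (<⇒≤ p<h))))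
                            , (λ q<dxy → InCopyG-inner (FX.TopPath.end-in-copy tp) (trans e≡ (cyc-Y (<⇒≤ h<q) q<dxy))) ]′ inner-end)

  record XYGeodesic {s e n} (w : Walk s e n) : Set where
    field
      copy   : Bool
      covers : ∀ x → 0 < x → x < dxy → cyc copy x ∈ trace w
      only   : ∀ {g} → g ∈ trace w → ∃[ x ] x ≤ dxy × g ≡ cyc copy x

  xy-geodesic : ∀ {s e n} (w : Walk s e n) → proj₁ s ≡ leaf X → proj₁ e ≡ leaf Y → n ≤ dxy → XYGeodesic w
  xy-geodesic {s} {e} {n} w s≡ e≡ n≤dxy = record
    { copy = β ; covers = top-cover tp ≤-refl ; only = only }
    where
      e≡′ : proj₁ e ≡ cyc Bool.false dxy
      e≡′ = trans e≡ (sym cyc-y)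
      tp = over-top {b = Bool.false} w s≡ e≡′ (s≤s z≤n) h<dxy ≤-refl (subst (_≤ dxy) (sym (+-identityʳ n)) n≤dxy)
      open FX.TopPath tp renaming (copy to β; only to top-only)
      from-Y : ∀ {g i} → dxy ∸ dxy < i → i ≤ h → g ≡ inner β (drop i Y) → ∃[ x ] x ≤ dxy × g ≡ cyc β x
      from-Y {i = i} 0<i i≤h g≡ = dxy ∸ i , m∸n≤m dxy i ,
        trans g≡ (trans (cong (λ z → inner β (drop z Y)) (sym (m∸[m∸n]≡n i≤dxy)))
          (sym (cyc-Y (subst (_≤ dxy ∸ i) dxy∸h (∸-monoʳ-≤ dxy i≤h)) (∸-monoʳ-< (subst (_< i) (n∸n≡0 dxy) 0<i) i≤dxy))))
        where i≤dxy = ≤-trans i≤h (<⇒≤ h<dxy)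
      only : ∀ {g} → g ∈ trace w → ∃[ x ] x ≤ dxy × g ≡ cyc β x
      only m = Data.Sum.[ (λ g≡s → 0 , z≤n , trans g≡s s≡)
             , Data.Sum.[ (λ g≡e → dxy , ≤-refl , trans g≡e (trans e≡ (sym cyc-y)))
             , Data.Sum.[ (λ { (i , 0<i , i≤h , g≡) → i , ≤-trans i≤h (<⇒≤ h<dxy) , trans g≡ (sym (cyc-X 0<i i≤h)) })
                        , (λ { (i , 0<i , i≤h , g≡) → from-Y 0<i i≤h g≡ }) ]′ ]′ ]′ (top-only m)

  HalfOpen : ℕ → ℕ → ℕ → Set
  HalfOpen p q x = (p < x × x ≤ q) ⊎ (q ≤ x × x < p)

  -- A shortest walk between the two halves of C_{x,y} changes copies below its lower end: it follows
  -- the half of its start from p to position q, or the half of its end from position p to q.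
  CrossCover : ∀ {s e n} → Walk s e n → Bool → Bool → ℕ → ℕ → Set
  CrossCover w b b′ p q = (ht q ≤ ht p × (∀ x → HalfOpen p q x → cyc b x ∈ trace w))
                        ⊎ (ht p ≤ ht q × (∀ x → HalfOpen q p x → cyc b′ x ∈ trace w))

  CrossCover-reverse : ∀ {s e n b b′ p q} (w : Walk s e n) → CrossCover (reverseʷ w) b′ b q p → CrossCover w b b′ p q
  CrossCover-reverse w (inj₁ (le , f)) = inj₂ (le , λ x hx → reverseʷ-⊆ w (f x hx))
  CrossCover-reverse w (inj₂ (le , f)) = inj₁ (le , λ x hx → reverseʷ-⊆ w (f x hx))

  detour-sym : ∀ p q → detour p q ≡ detour q p
  detour-sym p q = cong₂ _+_ (∣-∣-comm p q) (cong (λ m → m + m) (⊓-comm (ht p) (ht q)))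

  detour-X : ∀ {p q} → q ≤ p → p ≤ h → detour p q ≡ p + q
  detour-X {p} {q} q≤p p≤h = begin
    ∣ p - q ∣ + (ht p ⊓ ht q + ht p ⊓ ht q) ≡⟨ cong₂ (λ d m → d + (m + m)) (m≤n⇒∣n-m∣≡n∸m q≤p)
                                                (trans (cong₂ _⊓_ (ht-X p≤h) (ht-X (≤-trans q≤p p≤h))) (m≥n⇒m⊓n≡n q≤p)) ⟩
    p ∸ q + (q + q)                         ≡⟨ +-assoc (p ∸ q) q q ⟨
    p ∸ q + q + q                           ≡⟨ cong (_+ q) (m∸n+n≡m q≤p) ⟩
    p + q                                   ∎
    where open ≡-Reasoning

  detour-Y : ∀ {p q} → h ≤ p → p ≤ q → q ≤ dxy → detour p q ≡ (dxy ∸ p) + (dxy ∸ q)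
  detour-Y {p} {q} h≤p p≤q q≤dxy = begin
    ∣ p - q ∣ + (ht p ⊓ ht q + ht p ⊓ ht q) ≡⟨ cong₂ (λ d m → d + (m + m)) (m≤n⇒∣m-n∣≡n∸m p≤q)
                                                (trans (cong₂ _⊓_ (ht-Y h≤p) (ht-Y (≤-trans h≤p p≤q)))
                                                  (m≥n⇒m⊓n≡n (∸-monoʳ-≤ dxy p≤q))) ⟩
    q ∸ p + ((dxy ∸ q) + (dxy ∸ q))         ≡⟨ +-assoc (q ∸ p) (dxy ∸ q) (dxy ∸ q) ⟨
    q ∸ p + (dxy ∸ q) + (dxy ∸ q)           ≡⟨ cong (_+ (dxy ∸ q)) (∸-split p≤q q≤dxy) ⟩
    dxy ∸ p + (dxy ∸ q)                     ∎
    where open ≡-Reasoning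

  detour-XY-budget : ∀ {n p q} → p ≤ h → h ≤ q → q ≤ dxy → n ≤ detour p q →
    n + p + (dxy ∸ q) ≤ dxy + (p ⊓ (dxy ∸ q) + p ⊓ (dxy ∸ q))
  detour-XY-budget {n} {p} {q} p≤h h≤q q≤dxy budget = begin
    n + p + (dxy ∸ q)                   ≤⟨ +-monoˡ-≤ (dxy ∸ q) (+-monoˡ-≤ p (subst (n ≤_) detour≡ budget)) ⟩
    (q ∸ p) + (m + m) + p + (dxy ∸ q)   ≡⟨ +-shuffle (q ∸ p) (m + m) p (dxy ∸ q) ⟩
    (q ∸ p) + p + (dxy ∸ q) + (m + m)   ≡⟨ cong (λ z → z + (dxy ∸ q) + (m + m)) (m∸n+n≡m p≤q) ⟩
    q + (dxy ∸ q) + (m + m)             ≡⟨ cong (_+ (m + m)) (m+[n∸m]≡n q≤dxy) ⟩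
    dxy + (m + m)                       ∎
    where
      open ≤-Reasoning
      m = p ⊓ (dxy ∸ q)
      p≤q = ≤-trans p≤h h≤q
      detour≡ : detour p q ≡ (q ∸ p) + (m + m)
      detour≡ = cong₂ (λ d m → d + (m + m)) (m≤n⇒∣m-n∣≡n∸m p≤q) (cong₂ _⊓_ (ht-X p≤h) (ht-Y h≤q))

  cross-X : ∀ {s e n b b′ p q} (w : Walk s e n) → proj₁ s ≡ cyc b p → proj₁ e ≡ cyc b′ q → b ≢ b′ →
    0 < q → q < p → p ≤ h → n ≤ detour p q → CrossCover w b b′ p q
  cross-X {n = n} {b = b} {p = p} {q} w s≡ e≡ b≢b′ 0<q q<p p≤h budget =
    inj₁ (subst₂ _≤_ (sym (ht-X q≤h)) (sym (ht-X p≤h)) (<⇒≤ q<p) , cover)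
    where
      q≤h = ≤-trans (<⇒≤ q<p) p≤h
      visits : Visits b X q p w
      visits = cross-copies-on-line X lX w (trans s≡ (cyc-X (<-trans 0<q q<p) p≤h)) (trans e≡ (cyc-X 0<q q≤h)) b≢b′
                 0<q (<⇒≤ q<p) (≤-trans p≤h h≤r) (subst (n ≤_) (detour-X (<⇒≤ q<p) p≤h) budget)
      cover : ∀ x → HalfOpen p q x → cyc b x ∈ trace w
      cover x (inj₁ (p<x , x≤q)) = ⊥-elim (<-asym q<p (<-≤-trans p<x x≤q))
      cover x (inj₂ (q≤x , x<p)) = cyc-X∈ (<-≤-trans 0<q q≤x) (≤-trans (<⇒≤ x<p) p≤h) (visits x q≤x (<⇒≤ x<p))

  cross-Y : ∀ {s e n b b′ p q} (w : Walk s e n) → proj₁ s ≡ cyc b p → proj₁ e ≡ cyc b′ q → b ≢ b′ →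
    h ≤ p → p < q → q < dxy → n ≤ detour p q → CrossCover w b b′ p q
  cross-Y {n = n} {b = b} {p = p} {q} w s≡ e≡ b≢b′ h≤p p<q q<dxy budget =
    inj₁ (subst₂ _≤_ (sym (ht-Y h≤q)) (sym (ht-Y h≤p)) (∸-monoʳ-≤ dxy (<⇒≤ p<q)) , cover)
    where
      h≤q = ≤-trans h≤p (<⇒≤ p<q)
      visits : Visits b Y (dxy ∸ q) (dxy ∸ p) w
      visits = cross-copies-on-line Y lY w (trans s≡ (cyc-Y h≤p (<-trans p<q q<dxy))) (trans e≡ (cyc-Y h≤q q<dxy)) b≢b′
                 (m<n⇒0<n∸m q<dxy) (∸-monoʳ-≤ dxy (<⇒≤ p<q)) (≤-trans (mirror≤h h≤p) h≤r)
                 (subst (n ≤_) (detour-Y h≤p (<⇒≤ p<q) (<⇒≤ q<dxy)) budget)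
      cover : ∀ x → HalfOpen p q x → cyc b x ∈ trace w
      cover x (inj₁ (p<x , x≤q)) = cyc-Y∈ (≤-trans h≤p (<⇒≤ p<x)) (≤-<-trans x≤q q<dxy)
                                     (visits (dxy ∸ x) (∸-monoʳ-≤ dxy x≤q) (∸-monoʳ-≤ dxy (<⇒≤ p<x)))
      cover x (inj₂ (q≤x , x<p)) = ⊥-elim (<-asym p<q (≤-<-trans q≤x x<p))

  cover-XY : ∀ {β p q s e n} {w : Walk s e n} → 0 < p → q < dxy → Visits β X p h w → Visits β Y (dxy ∸ q) h w →
    ∀ x → p ≤ x → x ≤ q → cyc β x ∈ trace w
  cover-XY 0<p q<dxy vX vY x p≤x x≤q with x ≤? h
  ... | yes x≤h = cyc-X∈ (<-≤-trans 0<p p≤x) x≤h (vX x p≤x x≤h)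
  ... | no  x≰h = cyc-Y∈ (<⇒≤ (≰⇒> x≰h)) (≤-<-trans x≤q q<dxy)
                    (vY (dxy ∸ x) (∸-monoʳ-≤ dxy x≤q) (mirror≤h (<⇒≤ (≰⇒> x≰h))))

  cross-XY : ∀ {s e n b b′ p q} (w : Walk s e n) → proj₁ s ≡ cyc b p → proj₁ e ≡ cyc b′ q → b ≢ b′ →
    0 < p → p < h → h < q → q < dxy → n ≤ detour p q → CrossCover w b b′ p q
  cross-XY {b = b} {b′} {p} {q} w s≡ e≡ b≢b′ 0<p p<h h<q q<dxy budget with
    FY.opposite-cross w (trans s≡ (cyc-X 0<p (<⇒≤ p<h))) (trans e≡ (cyc-Y (<⇒≤ h<q) q<dxy)) b≢b′
      0<p (<⇒≤ p<h) (m<n⇒0<n∸m q<dxy) (mirror<h h<q (<⇒≤ q<dxy))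
      (detour-XY-budget (<⇒≤ p<h) (<⇒≤ h<q) (<⇒≤ q<dxy) budget)
  ... | inj₁ (l≤k , visits-X , visits-Y) =
    inj₁ (subst₂ _≤_ (sym (ht-Y (<⇒≤ h<q))) (sym (ht-X (<⇒≤ p<h))) l≤k ,
          λ { x (inj₁ (p<x , x≤q)) → cover-XY 0<p q<dxy visits-X visits-Y x (<⇒≤ p<x) x≤q
            ; x (inj₂ (q≤x , x<p)) → ⊥-elim (<-asym (<-trans p<h h<q) (≤-<-trans q≤x x<p)) })
  ... | inj₂ (k≤l , visits-X , visits-Y) =
    inj₂ (subst₂ _≤_ (sym (ht-X (<⇒≤ p<h))) (sym (ht-Y (<⇒≤ h<q))) k≤l ,
          λ { x (inj₁ (q<x , x≤p)) → ⊥-elim (<-asym (<-trans p<h h<q) (<-≤-trans q<x x≤p))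
            ; x (inj₂ (p≤x , x<q)) → cover-XY 0<p q<dxy visits-X visits-Y x p≤x (<⇒≤ x<q) })

  cross-visits-< : ∀ {s e n b b′ p q} (w : Walk s e n) → proj₁ s ≡ cyc b p → proj₁ e ≡ cyc b′ q → b ≢ b′ →
    0 < p → p < q → q < dxy → n ≤ detour p q → CrossCover w b b′ p q
  cross-visits-< {n = n} {p = p} {q} w s≡ e≡ b≢b′ 0<p p<q q<dxy budget with q ≤? h | h ≤? p
  ... | yes q≤h | _       = CrossCover-reverse w
                              (cross-X (reverseʷ w) e≡ s≡ (≢-sym b≢b′) 0<p p<q q≤h (subst (n ≤_) (detour-sym p q) budget))
  ... | no  _   | yes h≤p = cross-Y w s≡ e≡ b≢b′ h≤p p<q q<dxy budget
  ... | no  q≰h | no  h≰p = cross-XY w s≡ e≡ b≢b′ 0<p (≰⇒> h≰p) (≰⇒> q≰h) q<dxy budget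

  cross-visits : ∀ {s e n b b′ p q} (w : Walk s e n) → proj₁ s ≡ cyc b p → proj₁ e ≡ cyc b′ q → b ≢ b′ →
    0 < p → p < dxy → 0 < q → q < dxy → n ≤ detour p q → CrossCover w b b′ p q
  cross-visits {n = n} {p = p} {q} w s≡ e≡ b≢b′ 0<p p<dxy 0<q q<dxy budget with <-cmp p q
  ... | tri≈ _ refl _ = inj₁ (≤-refl , λ { x (inj₁ (p<x , x≤p)) → ⊥-elim (<⇒≱ p<x x≤p)
                                         ; x (inj₂ (p≤x , x<p)) → ⊥-elim (<⇒≱ x<p p≤x) })
  ... | tri< p<q _ _ = cross-visits-< w s≡ e≡ b≢b′ 0<p p<q q<dxy budget
  ... | tri> _ _ q<p = CrossCover-reverse w
                         (cross-visits-< (reverseʷ w) e≡ s≡ (≢-sym b≢b′) 0<q q<p p<dxy (subst (n ≤_) (detour-sym p q) budget))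

module Visibility {r t : ℕ} (X Y : List (Fin t)) (lX : length X ≡ r) (lY : length Y ≡ r)
  (h′ : ℕ) (h≤r : suc h′ ≤ r) (top : drop (suc h′) X ≡ drop (suc h′) Y) (apart : drop h′ X ≢ drop h′ Y)
  (S : Vert r t → Set) (mv : IsMutualVisibilitySet S) where
  open Walks {r} {t}
  open Cycle X Y lX lY h′ h≤r top apart

  record Point : Set where
    field
      vertex : V
      in-S   : S vertex
      copy   : Bool
      pos    : ℕ
      pos≤   : pos ≤ dxy
      at     : proj₁ vertex ≡ cyc copy pos
  open Point

  -- a record, so that the points can be inferred
  record _≠_ (e e′ : Point) : Set where
    constructor distinct
    field differ : proj₁ (vertex e) ≢ proj₁ (vertex e′)
  open _≠_

  ≢⇒≠ : ∀ {e e′} → vertex e ≢ vertex e′ → e ≠ e′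
  ≢⇒≠ e≢e′ = distinct (λ eq → e≢e′ (vertex-≡ eq))

  ≠-sym : ∀ {e e′} → e ≠ e′ → e′ ≠ e
  ≠-sym (distinct e≠e′) = distinct (≢-sym e≠e′)

  blocked : ∀ (e₁ e₂ : Point) → e₁ ≠ e₂ → ∀ {N} → Walk (vertex e₁) (vertex e₂) N →
    (∀ {n} (w : Walk (vertex e₁) (vertex e₂) n) → n ≤ N → ∃[ z ] z ≠ e₁ × z ≠ e₂ × proj₁ (vertex z) ∈ trace w) → ⊥
  blocked e₁ e₂ e₁≠e₂ []        _       = differ e₁≠e₂ refl
  blocked e₁ e₂ e₁≠e₂ {suc N} (a ∷ w₀) blocker = hidden (proj₁ found) (proj₁ (proj₂ found)) (proj₂ (proj₂ found))
    where
      visible = mv (vertex e₁) (vertex e₂) (in-S e₁) (in-S e₂) (λ eq → differ e₁≠e₂ (cong proj₁ eq))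
      mid = proj₁ visible
      shortest = proj₁ (proj₂ visible)
      walk = walk-of-linked (vertex e₁) mid (vertex e₂) (proj₁ (proj₁ shortest))
      module L = LinkedPath (linked-of-walk (a ∷ w₀))
      short : suc (length mid) ≤ suc N
      short = s≤s (≤-trans (proj₂ shortest L.mid (L.linked , All.universal (λ _ → tt) _)) (≤-reflexive L.length≡))
      z = blocker (proj₁ walk) short
      zv = vertex (proj₁ z)
      z∈ : proj₁ zv ∈ map proj₁ (vertex e₁ ∷ mid ++ vertex e₂ ∷ [])
      z∈ = subst (λ vs → proj₁ zv ∈ map proj₁ vs) (proj₂ walk) (proj₂ (proj₂ (proj₂ z)))
      found = ∈-map⁻ proj₁ z∈
      hidden : ∀ v → v ∈ vertex e₁ ∷ mid ++ vertex e₂ ∷ [] → proj₁ zv ≡ proj₁ v → ⊥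
      hidden v (here refl) eq = differ (proj₁ (proj₂ z)) eq
      hidden v (there v∈) eq with ∈-++⁻ mid v∈
      ... | inj₁ v∈mid       = All.lookup (proj₂ (proj₂ visible)) v∈mid (subst S (vertex-≡ eq) (in-S (proj₁ z)))
      ... | inj₂ (here refl) = differ (proj₁ (proj₂ (proj₂ z))) eq

  On : Bool → Point → Set
  On β e = proj₁ (vertex e) ≡ cyc β (pos e)

  Leaf Inner : Point → Set
  Leaf e  = pos e ≡ 0 ⊎ pos e ≡ dxy
  Inner e = 0 < pos e × pos e < dxy

  leaf-or-inner : (e : Point) → Leaf e ⊎ Inner e
  leaf-or-inner e with pos e ≟ 0 | pos e ≟ dxy
  ... | yes p≡0 | _         = inj₁ (inj₁ p≡0)
  ... | no  _   | yes p≡dxy = inj₁ (inj₂ p≡dxy)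
  ... | no  p≢0 | no  p≢dxy = inj₂ (≤∧≢⇒< z≤n (≢-sym p≢0) , ≤∧≢⇒< (pos≤ e) p≢dxy)

  leaf-on : ∀ {e} → Leaf e → ∀ β → On β e
  leaf-on {e} (inj₁ p≡0)   β = trans (at e) (trans (cong (cyc (copy e)) p≡0) (cong (cyc β) (sym p≡0)))
  leaf-on {e} (inj₂ p≡dxy) β = trans (at e) (trans (cong (cyc (copy e)) p≡dxy)
                                  (trans cyc-y (trans (sym cyc-y) (cong (cyc β) (sym p≡dxy)))))

  on-copy : ∀ e {β} → copy e ≡ β → On β e
  on-copy e refl = at e

  distinct-pos : ∀ β {e e′} → On β e → On β e′ → e ≠ e′ → pos e ≢ pos e′
  distinct-pos β o o′ e≠e′ p≡p′ = differ e≠e′ (trans o (trans (cong (cyc β) p≡p′) (sym o′)))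

  walk-between : ∀ β (e₁ e₂ : Point) → On β e₁ → On β e₂ → Walk (vertex e₁) (vertex e₂) ∣ pos e₁ - pos e₂ ∣
  walk-between β e₁ e₂ o₁ o₂ =
    subst₂ (λ u v → Walk u v _) (vertex-≡ (sym o₁)) (vertex-≡ (sym o₂)) (proj₁ (arc β (pos≤ e₁) (pos≤ e₂)))

  middle-blocks : ∀ β (e₁ e₂ e₃ : Point) → On β e₁ → On β e₂ → On β e₃ → pos e₁ < pos e₂ → pos e₂ < pos e₃ →
    0 < pos e₁ ⊎ pos e₃ < dxy → e₁ ≠ e₂ → e₁ ≠ e₃ → e₂ ≠ e₃ → ⊥
  middle-blocks β e₁ e₂ e₃ o₁ o₂ o₃ p₁<p₂ p₂<p₃ inner-end d₁₂ d₁₃ d₂₃ =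
    blocked e₁ e₃ d₁₃ (walk-between β e₁ e₃ o₁ o₃) λ {n} w n≤ →
      e₂ , ≠-sym d₁₂ , d₂₃ ,
      subst (_∈ trace w) (sym o₂) (between-on-half w o₁ o₃ p₁<p₃ (pos≤ e₃) inner-end (budget n≤) (pos e₂) p₁<p₂ p₂<p₃)
    where
      p₁<p₃ = <-trans p₁<p₂ p₂<p₃
      budget : ∀ {n} → n ≤ ∣ pos e₁ - pos e₃ ∣ → n + pos e₁ ≤ pos e₃
      budget {n} n≤ = ≤-trans (+-monoˡ-≤ (pos e₁) (subst (n ≤_) (m≤n⇒∣m-n∣≡n∸m (<⇒≤ p₁<p₃)) n≤)) (≤-reflexive (m∸n+n≡m (<⇒≤ p₁<p₃)))

  -- the middle one of three points on a half blocks the outer two, unless these are x and y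
  three-on-half : ∀ β (e₁ e₂ e₃ : Point) → On β e₁ → On β e₂ → On β e₃ → Inner e₂ → Inner e₃ →
    e₁ ≠ e₂ → e₁ ≠ e₃ → e₂ ≠ e₃ → ⊥
  three-on-half β e₁ e₂ e₃ o₁ o₂ o₃ (0<p₂ , p₂<dxy) (0<p₃ , p₃<dxy) d₁₂ d₁₃ d₂₃
    with <-cmp (pos e₁) (pos e₂) | <-cmp (pos e₁) (pos e₃) | <-cmp (pos e₂) (pos e₃)
  ... | tri≈ _ p₁≡p₂ _ | _ | _ = distinct-pos β o₁ o₂ d₁₂ p₁≡p₂
  ... | _ | tri≈ _ p₁≡p₃ _ | _ = distinct-pos β o₁ o₃ d₁₃ p₁≡p₃
  ... | _ | _ | tri≈ _ p₂≡p₃ _ = distinct-pos β o₂ o₃ d₂₃ p₂≡p₃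
  ... | tri< l₁₂ _ _ | tri< _ _ _   | tri< l₂₃ _ _ = middle-blocks β e₁ e₂ e₃ o₁ o₂ o₃ l₁₂ l₂₃ (inj₂ p₃<dxy) d₁₂ d₁₃ d₂₃
  ... | tri< _ _ _   | tri< l₁₃ _ _ | tri> _ _ l₃₂ = middle-blocks β e₁ e₃ e₂ o₁ o₃ o₂ l₁₃ l₃₂ (inj₂ p₂<dxy) d₁₃ d₁₂ (≠-sym d₂₃)
  ... | tri< l₁₂ _ _ | tri> _ _ l₃₁ | _            = middle-blocks β e₃ e₁ e₂ o₃ o₁ o₂ l₃₁ l₁₂ (inj₁ 0<p₃) (≠-sym d₁₃) (≠-sym d₂₃) d₁₂
  ... | tri> _ _ l₂₁ | tri< l₁₃ _ _ | _            = middle-blocks β e₂ e₁ e₃ o₂ o₁ o₃ l₂₁ l₁₃ (inj₁ 0<p₂) (≠-sym d₁₂) d₂₃ d₁₃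
  ... | tri> _ _ _   | tri> _ _ l₃₁ | tri< l₂₃ _ _ = middle-blocks β e₂ e₃ e₁ o₂ o₃ o₁ l₂₃ l₃₁ (inj₁ 0<p₂) d₂₃ (≠-sym d₁₂) (≠-sym d₁₃)
  ... | tri> _ _ l₂₁ | tri> _ _ _   | tri> _ _ l₃₂ = middle-blocks β e₃ e₂ e₁ o₃ o₂ o₁ l₃₂ l₂₁ (inj₁ 0<p₃) (≠-sym d₂₃) (≠-sym d₁₃) (≠-sym d₁₂)

  other-copy : ∀ {b b′ β : Bool} → b ≢ b′ → β ≢ b → β ≡ b′
  other-copy b≢b′ β≢b = trans (¬-not β≢b) (sym (¬-not (≢-sym b≢b′)))

  xy-blocked : ∀ (ex ey e₁ e₂ : Point) → pos ex ≡ 0 → pos ey ≡ dxy → Inner e₁ → Inner e₂ → copy e₁ ≢ copy e₂ →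
    ex ≠ ey → e₁ ≠ ex → e₁ ≠ ey → e₂ ≠ ex → e₂ ≠ ey → ⊥
  xy-blocked ex ey e₁ e₂ x0 yd (0<p₁ , p₁<dxy) (0<p₂ , p₂<dxy) c₁≢c₂ dxy′ d₁x d₁y d₂x d₂y =
    blocked ex ey dxy′ (walk-between Bool.false ex ey ox oy) blocker
    where
      ox = leaf-on {ex} (inj₁ x0) Bool.false
      oy = leaf-on {ey} (inj₂ yd) Bool.false
      blocker : ∀ {n} (w : Walk (vertex ex) (vertex ey) n) → n ≤ ∣ pos ex - pos ey ∣ →
        ∃[ z ] z ≠ ex × z ≠ ey × proj₁ (vertex z) ∈ trace w
      blocker {n} w n≤ = by-copy (copy e₁ Data.Bool.≟ XYGeodesic.copy g)
        where
          g = xy-geodesic w (trans ox (cong (cyc Bool.false) x0)) (trans oy (trans (cong (cyc Bool.false) yd) cyc-y))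
                (subst (n ≤_) (trans (cong₂ ∣_-_∣ x0 yd) (∣-∣-identityˡ dxy)) n≤)
          by-copy : Dec (copy e₁ ≡ XYGeodesic.copy g) → ∃[ z ] z ≠ ex × z ≠ ey × proj₁ (vertex z) ∈ trace w
          by-copy (yes c₁≡) = e₁ , d₁x , d₁y , subst (_∈ trace w) (sym (on-copy e₁ c₁≡)) (XYGeodesic.covers g (pos e₁) 0<p₁ p₁<dxy)
          by-copy (no  c₁≢) = e₂ , d₂x , d₂y , subst (_∈ trace w) (sym (on-copy e₂ (sym (other-copy c₁≢c₂ (≢-sym c₁≢)))))
                                                 (XYGeodesic.covers g (pos e₂) 0<p₂ p₂<dxy)

  -- ht rises up to h and falls afterwards
  tent : ∀ {a b c d} → a < b → b < c → c < d → d ≤ dxy → ht c ≤ ht a → ht b ≤ ht d → ⊥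
  tent {a} {b} {c} {d} a<b b<c c<d d≤dxy hc≤ha hb≤hd =
    <-asym (∸-monoʳ-< c<d d≤dxy) (≤-<-trans mirror-c≤a (<-≤-trans a<b b≤mirror-d))
    where
      mirror-c≤a : dxy ∸ c ≤ a
      mirror-c≤a with ⊓-sel c (dxy ∸ c)
      ... | inj₁ hc≡c = ⊥-elim (<⇒≱ (<-trans a<b b<c) (≤-trans (≤-reflexive (sym hc≡c)) (≤-trans hc≤ha (m⊓n≤m a _))))
      ... | inj₂ hc≡  = ≤-trans (≤-reflexive (sym hc≡)) (≤-trans hc≤ha (m⊓n≤m a _))
      b≤mirror-d : b ≤ dxy ∸ d
      b≤mirror-d with ⊓-sel b (dxy ∸ b)
      ... | inj₁ hb≡b = ≤-trans (≤-reflexive (sym hb≡b)) (≤-trans hb≤hd (m⊓n≤n d _))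
      ... | inj₂ hb≡  = ⊥-elim (<⇒≱ (∸-monoʳ-< (<-trans b<c c<d) d≤dxy)
                                  (≤-trans (≤-reflexive (sym hb≡)) (≤-trans hb≤hd (m⊓n≤n d _))))

  HalfOpen? : ∀ p q x → Dec (HalfOpen p q x)
  HalfOpen? p q x = ((p <? x) ×-dec (x ≤? q)) ⊎-dec ((q ≤? x) ×-dec (x <? p))

  -- shortest walks between positions p and q on different halves may avoid the points at pu on
  -- the half of p and at pv on the half of q
  Escapes : ℕ → ℕ → ℕ → ℕ → Set
  Escapes p q pu pv = (ht q ≤ ht p × ¬ HalfOpen p q pu) ⊎ (ht p ≤ ht q × ¬ HalfOpen q p pv)

  Escapes? : ∀ p q pu pv → Dec (Escapes p q pu pv)
  Escapes? p q pu pv = ((ht q ≤? ht p) ×-dec ¬? (HalfOpen? p q pu)) ⊎-dec ((ht p ≤? ht q) ×-dec ¬? (HalfOpen? q p pv))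

  walk-across : ∀ (a c : Point) → Walk (vertex a) (vertex c) (detour (pos a) (pos c))
  walk-across a c = subst₂ (λ u v → Walk u v _) (vertex-≡ (sym (at a))) (vertex-≡ (sym (at c)))
                      (cross-walk (copy a) (copy c) (pos≤ a) (pos≤ c))

  cross-escape : ∀ (a c u v : Point) → copy a ≢ copy c → copy u ≡ copy a → copy v ≡ copy c → Inner a → Inner c →
    a ≠ c → u ≠ a → u ≠ c → v ≠ a → v ≠ c → Escapes (pos a) (pos c) (pos u) (pos v)
  cross-escape a c u v a≢c u∼a v∼c (0<p , p<dxy) (0<q , q<dxy) dac dua duc dva dvc = escape (Escapes? _ _ _ _)
    where
      escape : Dec (Escapes (pos a) (pos c) (pos u) (pos v)) → Escapes (pos a) (pos c) (pos u) (pos v)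
      escape (yes esc)   = esc
      escape (no  stuck) = ⊥-elim (blocked a c dac (walk-across a c) blocker)
        where
          via-u : ∀ {n} (w : Walk (vertex a) (vertex c) n) → ht (pos c) ≤ ht (pos a) →
            (∀ x → HalfOpen (pos a) (pos c) x → cyc (copy a) x ∈ trace w) → Dec (HalfOpen (pos a) (pos c) (pos u)) →
            ∃[ z ] z ≠ a × z ≠ c × proj₁ (vertex z) ∈ trace w
          via-u w le f (yes hu) = u , dua , duc , subst (_∈ trace w) (sym (on-copy u u∼a)) (f (pos u) hu)
          via-u w le f (no ¬hu) = ⊥-elim (stuck (inj₁ (le , ¬hu)))
          via-v : ∀ {n} (w : Walk (vertex a) (vertex c) n) → ht (pos a) ≤ ht (pos c) →
            (∀ x → HalfOpen (pos c) (pos a) x → cyc (copy c) x ∈ trace w) → Dec (HalfOpen (pos c) (pos a) (pos v)) →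
            ∃[ z ] z ≠ a × z ≠ c × proj₁ (vertex z) ∈ trace w
          via-v w le f (yes hv) = v , dva , dvc , subst (_∈ trace w) (sym (on-copy v v∼c)) (f (pos v) hv)
          via-v w le f (no ¬hv) = ⊥-elim (stuck (inj₂ (le , ¬hv)))
          blocker : ∀ {n} (w : Walk (vertex a) (vertex c) n) → n ≤ detour (pos a) (pos c) →
            ∃[ z ] z ≠ a × z ≠ c × proj₁ (vertex z) ∈ trace w
          blocker w n≤ with cross-visits w (at a) (at c) a≢c 0<p p<dxy 0<q q<dxy n≤
          ... | inj₁ (le , f) = via-u w le f (HalfOpen? _ _ _)
          ... | inj₂ (le , f) = via-v w le f (HalfOpen? _ _ _)

  opposite-escapes : ∀ {p₁ p₂ p₃ p₄} → p₁ < p₂ → p₃ < p₄ → p₂ ≤ dxy → p₄ ≤ dxy →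
    Escapes p₁ p₄ p₂ p₃ → Escapes p₂ p₃ p₁ p₄ → ⊥
  opposite-escapes p₁<p₂ p₃<p₄ p₂≤ p₄≤ (inj₁ (h₄≤h₁ , ∉₁)) (inj₁ (h₃≤h₂ , ∉₂)) =
    tent (≰⇒> (λ p₃≤p₁ → ∉₂ (inj₂ (p₃≤p₁ , p₁<p₂)))) p₃<p₄ (≰⇒> (λ p₂≤p₄ → ∉₁ (inj₁ (p₁<p₂ , p₂≤p₄)))) p₂≤ h₄≤h₁ h₃≤h₂
  opposite-escapes p₁<p₂ p₃<p₄ p₂≤ p₄≤ (inj₁ (_ , ∉₁)) (inj₂ (_ , ∉₂)) =
    <-asym (≰⇒> (λ p₂≤p₄ → ∉₁ (inj₁ (p₁<p₂ , p₂≤p₄)))) (≰⇒> (λ p₄≤p₂ → ∉₂ (inj₁ (p₃<p₄ , p₄≤p₂))))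
  opposite-escapes p₁<p₂ p₃<p₄ p₂≤ p₄≤ (inj₂ (_ , ∉₁)) (inj₁ (_ , ∉₂)) =
    <-asym (≰⇒> (λ p₁≤p₃ → ∉₁ (inj₂ (p₁≤p₃ , p₃<p₄)))) (≰⇒> (λ p₃≤p₁ → ∉₂ (inj₂ (p₃≤p₁ , p₁<p₂))))
  opposite-escapes p₁<p₂ p₃<p₄ p₂≤ p₄≤ (inj₂ (h₁≤h₄ , ∉₁)) (inj₂ (h₂≤h₃ , ∉₂)) =
    tent (≰⇒> (λ p₁≤p₃ → ∉₁ (inj₂ (p₁≤p₃ , p₃<p₄)))) p₁<p₂ (≰⇒> (λ p₄≤p₂ → ∉₂ (inj₁ (p₃<p₄ , p₄≤p₂)))) p₄≤ h₂≤h₃ h₁≤h₄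

  two-and-two-sorted : ∀ (a₁ a₂ c₁ c₂ : Point) → copy a₁ ≡ copy a₂ → copy c₁ ≡ copy c₂ → copy a₁ ≢ copy c₁ →
    Inner a₁ → Inner a₂ → Inner c₁ → Inner c₂ → pos a₁ < pos a₂ → pos c₁ < pos c₂ →
    a₁ ≠ a₂ → a₁ ≠ c₁ → a₁ ≠ c₂ → a₂ ≠ c₁ → a₂ ≠ c₂ → c₁ ≠ c₂ → ⊥
  two-and-two-sorted a₁ a₂ c₁ c₂ ca cc a≢c ia₁ ia₂ ic₁ ic₂ l₁₂ l₃₄ d₁₂ d₁₃ d₁₄ d₂₃ d₂₄ d₃₄ =
    opposite-escapes l₁₂ l₃₄ (pos≤ a₂) (pos≤ c₂)
      (cross-escape a₁ c₂ a₂ c₁ (λ eq → a≢c (trans eq (sym cc))) (sym ca) cc ia₁ ic₂ d₁₄ (≠-sym d₁₂) d₂₄ (≠-sym d₁₃) d₃₄)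
      (cross-escape a₂ c₁ a₁ c₂ (λ eq → a≢c (trans ca eq)) ca (sym cc) ia₂ ic₁ d₂₃ d₁₂ d₁₃ (≠-sym d₂₄) (≠-sym d₃₄))

  two-and-two : ∀ (a₁ a₂ c₁ c₂ : Point) → copy a₁ ≡ copy a₂ → copy c₁ ≡ copy c₂ → copy a₁ ≢ copy c₁ →
    Inner a₁ → Inner a₂ → Inner c₁ → Inner c₂ →
    a₁ ≠ a₂ → a₁ ≠ c₁ → a₁ ≠ c₂ → a₂ ≠ c₁ → a₂ ≠ c₂ → c₁ ≠ c₂ → ⊥
  two-and-two a₁ a₂ c₁ c₂ ca cc a≢c ia₁ ia₂ ic₁ ic₂ d₁₂ d₁₃ d₁₄ d₂₃ d₂₄ d₃₄
    with <-cmp (pos a₁) (pos a₂) | <-cmp (pos c₁) (pos c₂)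
  ... | tri≈ _ eq _  | _ = distinct-pos (copy a₁) (at a₁) (on-copy a₂ (sym ca)) d₁₂ eq
  ... | _ | tri≈ _ eq _  = distinct-pos (copy c₁) (at c₁) (on-copy c₂ (sym cc)) d₃₄ eq
  ... | tri< l₁₂ _ _ | tri< l₃₄ _ _ =
    two-and-two-sorted a₁ a₂ c₁ c₂ ca cc a≢c ia₁ ia₂ ic₁ ic₂ l₁₂ l₃₄ d₁₂ d₁₃ d₁₄ d₂₃ d₂₄ d₃₄
  ... | tri< l₁₂ _ _ | tri> _ _ l₄₃ =
    two-and-two-sorted a₁ a₂ c₂ c₁ ca (sym cc) (λ eq → a≢c (trans eq (sym cc))) ia₁ ia₂ ic₂ ic₁ l₁₂ l₄₃
      d₁₂ d₁₄ d₁₃ d₂₄ d₂₃ (≠-sym d₃₄)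
  ... | tri> _ _ l₂₁ | tri< l₃₄ _ _ =
    two-and-two-sorted a₂ a₁ c₁ c₂ (sym ca) cc (λ eq → a≢c (trans ca eq)) ia₂ ia₁ ic₁ ic₂ l₂₁ l₃₄
      (≠-sym d₁₂) d₂₃ d₂₄ d₁₃ d₁₄ d₃₄
  ... | tri> _ _ l₂₁ | tri> _ _ l₄₃ =
    two-and-two-sorted a₂ a₁ c₂ c₁ (sym ca) (sym cc) (λ eq → a≢c (trans ca (trans eq (sym cc)))) ia₂ ia₁ ic₂ ic₁ l₂₁ l₄₃
      (≠-sym d₁₂) d₂₄ d₂₃ d₁₄ d₁₃ (≠-sym d₃₄)

  same-end : ∀ {l₁ l₂} → Leaf l₁ → Leaf l₂ → pos l₁ ≡ pos l₂ → l₁ ≠ l₂ → ⊥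
  same-end {l₁} {l₂} L₁ L₂ eq d = distinct-pos Bool.false (leaf-on {l₁} L₁ Bool.false) (leaf-on {l₂} L₂ Bool.false) d eq

  three-leaves : ∀ {l₁ l₂ l₃} → Leaf l₁ → Leaf l₂ → Leaf l₃ → l₁ ≠ l₂ → l₁ ≠ l₃ → l₂ ≠ l₃ → ⊥
  three-leaves (inj₁ x₁) (inj₁ x₂) _         d₁₂ _   _   = same-end (inj₁ x₁) (inj₁ x₂) (trans x₁ (sym x₂)) d₁₂
  three-leaves (inj₂ y₁) (inj₂ y₂) _         d₁₂ _   _   = same-end (inj₂ y₁) (inj₂ y₂) (trans y₁ (sym y₂)) d₁₂
  three-leaves (inj₁ x₁) (inj₂ _)  (inj₁ x₃) _   d₁₃ _   = same-end (inj₁ x₁) (inj₁ x₃) (trans x₁ (sym x₃)) d₁₃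
  three-leaves (inj₁ _)  (inj₂ y₂) (inj₂ y₃) _   _   d₂₃ = same-end (inj₂ y₂) (inj₂ y₃) (trans y₂ (sym y₃)) d₂₃
  three-leaves (inj₂ _)  (inj₁ x₂) (inj₁ x₃) _   _   d₂₃ = same-end (inj₁ x₂) (inj₁ x₃) (trans x₂ (sym x₃)) d₂₃
  three-leaves (inj₂ y₁) (inj₁ _)  (inj₂ y₃) _   d₁₃ _   = same-end (inj₂ y₁) (inj₂ y₃) (trans y₁ (sym y₃)) d₁₃

  both-leaves : ∀ (l₁ l₂ i₁ i₂ : Point) → Leaf l₁ → Leaf l₂ → Inner i₁ → Inner i₂ →
    l₁ ≠ l₂ → l₁ ≠ i₁ → l₁ ≠ i₂ → l₂ ≠ i₁ → l₂ ≠ i₂ → i₁ ≠ i₂ → ⊥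
  both-leaves l₁ l₂ i₁ i₂ L₁ L₂ n₁ n₂ d₁₂ d₁₃ d₁₄ d₂₃ d₂₄ d₃₄ with copy i₁ Data.Bool.≟ copy i₂
  ... | yes c≡ = three-on-half (copy i₁) l₁ i₁ i₂ (leaf-on {l₁} L₁ _) (at i₁) (on-copy i₂ (sym c≡)) n₁ n₂ d₁₃ d₁₄ d₃₄
  ... | no  c≢ with L₁ | L₂
  ...   | inj₁ x₁ | inj₂ y₂ = xy-blocked l₁ l₂ i₁ i₂ x₁ y₂ n₁ n₂ c≢ d₁₂ (≠-sym d₁₃) (≠-sym d₂₃) (≠-sym d₁₄) (≠-sym d₂₄)
  ...   | inj₂ y₁ | inj₁ x₂ = xy-blocked l₂ l₁ i₁ i₂ x₂ y₁ n₁ n₂ c≢ (≠-sym d₁₂) (≠-sym d₂₃) (≠-sym d₁₃) (≠-sym d₂₄) (≠-sym d₁₄)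
  ...   | inj₁ x₁ | inj₁ x₂ = same-end L₁ L₂ (trans x₁ (sym x₂)) d₁₂
  ...   | inj₂ y₁ | inj₂ y₂ = same-end L₁ L₂ (trans y₁ (sym y₂)) d₁₂

  one-leaf : ∀ (l i₁ i₂ i₃ : Point) → Leaf l → Inner i₁ → Inner i₂ → Inner i₃ →
    l ≠ i₁ → l ≠ i₂ → l ≠ i₃ → i₁ ≠ i₂ → i₁ ≠ i₃ → i₂ ≠ i₃ → ⊥
  one-leaf l i₁ i₂ i₃ L n₁ n₂ n₃ d₁ d₂ d₃ d₁₂ d₁₃ d₂₃
    with copy i₁ Data.Bool.≟ copy i₂ | copy i₁ Data.Bool.≟ copy i₃
  ... | yes c₁₂ | _       = three-on-half (copy i₁) l i₁ i₂ (leaf-on {l} L _) (at i₁) (on-copy i₂ (sym c₁₂)) n₁ n₂ d₁ d₂ d₁₂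
  ... | no  _   | yes c₁₃ = three-on-half (copy i₁) l i₁ i₃ (leaf-on {l} L _) (at i₁) (on-copy i₃ (sym c₁₃)) n₁ n₃ d₁ d₃ d₁₃
  ... | no  c₁₂ | no  c₁₃ = three-on-half (copy i₂) l i₂ i₃ (leaf-on {l} L _) (at i₂)
                              (on-copy i₃ (other-copy c₁₂ (≢-sym c₁₃))) n₂ n₃ d₂ d₃ d₂₃

  no-leaf : ∀ (i₁ i₂ i₃ i₄ : Point) → Inner i₁ → Inner i₂ → Inner i₃ → Inner i₄ →
    i₁ ≠ i₂ → i₁ ≠ i₃ → i₁ ≠ i₄ → i₂ ≠ i₃ → i₂ ≠ i₄ → i₃ ≠ i₄ → ⊥
  no-leaf i₁ i₂ i₃ i₄ n₁ n₂ n₃ n₄ d₁₂ d₁₃ d₁₄ d₂₃ d₂₄ d₃₄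
    with copy i₁ Data.Bool.≟ copy i₂ | copy i₁ Data.Bool.≟ copy i₃ | copy i₁ Data.Bool.≟ copy i₄
  ... | yes c₁₂ | yes c₁₃ | _ =
    three-on-half (copy i₁) i₁ i₂ i₃ (at i₁) (on-copy i₂ (sym c₁₂)) (on-copy i₃ (sym c₁₃)) n₂ n₃ d₁₂ d₁₃ d₂₃
  ... | yes c₁₂ | no  _   | yes c₁₄ =
    three-on-half (copy i₁) i₁ i₂ i₄ (at i₁) (on-copy i₂ (sym c₁₂)) (on-copy i₄ (sym c₁₄)) n₂ n₄ d₁₂ d₁₄ d₂₄
  ... | yes c₁₂ | no  c₁₃ | no  c₁₄ =
    two-and-two i₁ i₂ i₃ i₄ c₁₂ (sym (other-copy c₁₃ (≢-sym c₁₄))) c₁₃ n₁ n₂ n₃ n₄ d₁₂ d₁₃ d₁₄ d₂₃ d₂₄ d₃₄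
  ... | no  _   | yes c₁₃ | yes c₁₄ =
    three-on-half (copy i₁) i₁ i₃ i₄ (at i₁) (on-copy i₃ (sym c₁₃)) (on-copy i₄ (sym c₁₄)) n₃ n₄ d₁₃ d₁₄ d₃₄
  ... | no  c₁₂ | yes c₁₃ | no  c₁₄ =
    two-and-two i₁ i₃ i₂ i₄ c₁₃ (sym (other-copy c₁₂ (≢-sym c₁₄))) c₁₂ n₁ n₃ n₂ n₄ d₁₃ d₁₂ d₁₄ (≠-sym d₂₃) d₃₄ d₂₄
  ... | no  c₁₂ | no  c₁₃ | yes c₁₄ =
    two-and-two i₁ i₄ i₂ i₃ c₁₄ (sym (other-copy c₁₂ (≢-sym c₁₃))) c₁₂ n₁ n₄ n₂ n₃ d₁₄ d₁₂ d₁₃ (≠-sym d₂₄) (≠-sym d₃₄) d₂₃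
  ... | no  c₁₂ | no  c₁₃ | no  c₁₄ =
    three-on-half (copy i₂) i₂ i₃ i₄ (at i₂) (on-copy i₃ (other-copy c₁₂ (≢-sym c₁₃)))
      (on-copy i₄ (other-copy c₁₂ (≢-sym c₁₄))) n₃ n₄ d₂₃ d₂₄ d₃₄

  no-four-points : ∀ (e₁ e₂ e₃ e₄ : Point) → e₁ ≠ e₂ → e₁ ≠ e₃ → e₁ ≠ e₄ → e₂ ≠ e₃ → e₂ ≠ e₄ → e₃ ≠ e₄ → ⊥
  no-four-points e₁ e₂ e₃ e₄ d₁₂ d₁₃ d₁₄ d₂₃ d₂₄ d₃₄
    with leaf-or-inner e₁ | leaf-or-inner e₂ | leaf-or-inner e₃ | leaf-or-inner e₄
  ... | inj₁ L₁ | inj₁ L₂ | inj₁ L₃ | _       = three-leaves L₁ L₂ L₃ d₁₂ d₁₃ d₂₃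
  ... | inj₁ L₁ | inj₁ L₂ | inj₂ _  | inj₁ L₄ = three-leaves L₁ L₂ L₄ d₁₂ d₁₄ d₂₄
  ... | inj₁ L₁ | inj₂ _  | inj₁ L₃ | inj₁ L₄ = three-leaves L₁ L₃ L₄ d₁₃ d₁₄ d₃₄
  ... | inj₂ _  | inj₁ L₂ | inj₁ L₃ | inj₁ L₄ = three-leaves L₂ L₃ L₄ d₂₃ d₂₄ d₃₄
  ... | inj₁ L₁ | inj₁ L₂ | inj₂ n₃ | inj₂ n₄ = both-leaves e₁ e₂ e₃ e₄ L₁ L₂ n₃ n₄ d₁₂ d₁₃ d₁₄ d₂₃ d₂₄ d₃₄
  ... | inj₁ L₁ | inj₂ n₂ | inj₁ L₃ | inj₂ n₄ = both-leaves e₁ e₃ e₂ e₄ L₁ L₃ n₂ n₄ d₁₃ d₁₂ d₁₄ (≠-sym d₂₃) d₃₄ d₂₄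
  ... | inj₁ L₁ | inj₂ n₂ | inj₂ n₃ | inj₁ L₄ = both-leaves e₁ e₄ e₂ e₃ L₁ L₄ n₂ n₃ d₁₄ d₁₂ d₁₃ (≠-sym d₂₄) (≠-sym d₃₄) d₂₃
  ... | inj₂ n₁ | inj₁ L₂ | inj₁ L₃ | inj₂ n₄ = both-leaves e₂ e₃ e₁ e₄ L₂ L₃ n₁ n₄ d₂₃ (≠-sym d₁₂) d₂₄ (≠-sym d₁₃) d₃₄ d₁₄
  ... | inj₂ n₁ | inj₁ L₂ | inj₂ n₃ | inj₁ L₄ = both-leaves e₂ e₄ e₁ e₃ L₂ L₄ n₁ n₃ d₂₄ (≠-sym d₁₂) d₂₃ (≠-sym d₁₄) (≠-sym d₃₄) d₁₃
  ... | inj₂ n₁ | inj₂ n₂ | inj₁ L₃ | inj₁ L₄ = both-leaves e₃ e₄ e₁ e₂ L₃ L₄ n₁ n₂ d₃₄ (≠-sym d₁₃) (≠-sym d₂₃) (≠-sym d₁₄) (≠-sym d₂₄) d₁₂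
  ... | inj₁ L₁ | inj₂ n₂ | inj₂ n₃ | inj₂ n₄ = one-leaf e₁ e₂ e₃ e₄ L₁ n₂ n₃ n₄ d₁₂ d₁₃ d₁₄ d₂₃ d₂₄ d₃₄
  ... | inj₂ n₁ | inj₁ L₂ | inj₂ n₃ | inj₂ n₄ = one-leaf e₂ e₁ e₃ e₄ L₂ n₁ n₃ n₄ (≠-sym d₁₂) d₂₃ d₂₄ d₁₃ d₁₄ d₃₄
  ... | inj₂ n₁ | inj₂ n₂ | inj₁ L₃ | inj₂ n₄ = one-leaf e₃ e₁ e₂ e₄ L₃ n₁ n₂ n₄ (≠-sym d₁₃) (≠-sym d₂₃) d₃₄ d₁₂ d₁₄ d₂₄
  ... | inj₂ n₁ | inj₂ n₂ | inj₂ n₃ | inj₁ L₄ = one-leaf e₄ e₁ e₂ e₃ L₄ n₁ n₂ n₃ (≠-sym d₁₄) (≠-sym d₂₄) (≠-sym d₃₄) d₁₂ d₁₃ d₂₃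
  ... | inj₂ n₁ | inj₂ n₂ | inj₂ n₃ | inj₂ n₄ = no-leaf e₁ e₂ e₃ e₄ n₁ n₂ n₃ n₄ d₁₂ d₁₃ d₁₄ d₂₃ d₂₄ d₃₄

record Meeting {t : ℕ} (X Y : List (Fin t)) : Set where
  field
    h′    : ℕ
    h≤    : suc h′ ≤ length X
    top   : drop (suc h′) X ≡ drop (suc h′) Y
    apart : drop h′ X ≢ drop h′ Y

meeting : ∀ {t} (X Y : List (Fin t)) → length X ≡ length Y → X ≢ Y → Meeting X Y
meeting []      []      _  X≢Y = ⊥-elim (X≢Y refl)
meeting (a ∷ X) (b ∷ Y) eq X≢Y with ≡-dec Fin._≟_ X Y
... | yes X≡Y = record { h′ = 0 ; h≤ = s≤s z≤n ; top = X≡Y ; apart = X≢Y }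
... | no  X≢Y′ = record { h′ = suc h′ ; h≤ = s≤s h≤ ; top = top ; apart = apart }
  where open Meeting (meeting X Y (suc-injective eq) X≢Y′)

module CyclePoints {r t : ℕ} (X Y : List (Fin t)) (lX : length X ≡ r) (lY : length Y ≡ r)
  (h′ : ℕ) (h≤r : suc h′ ≤ r) (top : drop (suc h′) X ≡ drop (suc h′) Y) (apart : drop h′ X ≢ drop h′ Y)
  (S : Vert r t → Set) (mv : IsMutualVisibilitySet S) where
  open Walks {r} {t}
  open Cycle X Y lX lY h′ h≤r top apart
  open Visibility X Y lX lY h′ h≤r top apart S mv

  x y : V
  x = leaf X , lX
  y = leaf Y , lY

  -- the half of C_{x,y} in copy b is a walk of length dxy, so a shortest x–y path inside copy b
  -- has at most that length and is one of the two halves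
  point : (v : V) → S v → OnCycle x y v → Point
  point v v∈S (b , mid , ((linked , _) , shortest) , v∈) = record
    { vertex = v ; in-S = v∈S ; copy = XYGeodesic.copy g ; pos = proj₁ found
    ; pos≤ = proj₁ (proj₂ found) ; at = proj₂ (proj₂ found) }
    where
      half : CopyWalk b x y dxy
      half = cast (vertex-≡ refl) (vertex-≡ cyc-y) refl (arc b z≤n ≤-refl)
      module L = LinkedPath (linked-of-walk (proj₁ half))
      in-copy : All (InCopy b) (x ∷ L.mid ++ y ∷ [])
      in-copy = All.tabulate λ {u} u∈ → proj₂ half (∈-map⁺ proj₁ (subst (u ∈_) (sym L.vertices≡) u∈))
      walk = walk-of-linked x mid y linked
      g = xy-geodesic (proj₁ walk) refl refl (s≤s (≤-trans (shortest L.mid (L.linked , in-copy)) (≤-reflexive L.length≡)))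
      found : ∃[ p ] p ≤ dxy × proj₁ v ≡ cyc (XYGeodesic.copy g) p
      found = XYGeodesic.only g (∈-map⁺ proj₁ (subst (v ∈_) (sym (proj₂ walk)) v∈))

mainTheorem6 : (r t : ℕ) → 1 ≤ r → 2 ≤ t →
    (S : Vert r t → Set) → IsMutualVisibilitySet S →
    (x y : Vert r t) → IsQuasiLeaf x → IsQuasiLeaf y → x ≢ y →
    (vs : List (Vert r t)) → Unique vs → All (λ v → S v × OnCycle x y v) vs →
    length vs ≤ 3
mainTheorem6 r t _ _ S mv (leaf X , lX) (leaf Y , lY) tt tt x≢y = at-most-three
  where
    open Meeting (meeting X Y (trans lX (sym lY)) (λ X≡Y → x≢y (vertex-≡ (cong leaf X≡Y))))
    open CyclePoints X Y lX lY h′ (subst (suc h′ ≤_) lX h≤) top apart S mv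
    open Visibility X Y lX lY h′ (subst (suc h′ ≤_) lX h≤) top apart S mv using (≢⇒≠; no-four-points)
    at-most-three : (vs : List (Vert r t)) → Unique vs → All (λ v → S v × OnCycle x y v) vs → length vs ≤ 3
    at-most-three []                   _ _ = z≤n
    at-most-three (_ ∷ [])             _ _ = s≤s z≤n
    at-most-three (_ ∷ _ ∷ [])         _ _ = s≤s (s≤s z≤n)
    at-most-three (_ ∷ _ ∷ _ ∷ [])     _ _ = s≤s (s≤s (s≤s z≤n))
    at-most-three (v₁ ∷ v₂ ∷ v₃ ∷ v₄ ∷ _) ((d₁₂ ∷ d₁₃ ∷ d₁₄ ∷ _) ∷ (d₂₃ ∷ d₂₄ ∷ _) ∷ (d₃₄ ∷ _) ∷ _)
                  ((s₁ , o₁) ∷ (s₂ , o₂) ∷ (s₃ , o₃) ∷ (s₄ , o₄) ∷ _) =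
      ⊥-elim (no-four-points (point v₁ s₁ o₁) (point v₂ s₂ o₂) (point v₃ s₃ o₃) (point v₄ s₄ o₄)
        (≢⇒≠ d₁₂) (≢⇒≠ d₁₃) (≢⇒≠ d₁₄) (≢⇒≠ d₂₃) (≢⇒≠ d₂₄) (≢⇒≠ d₃₄))
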